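{- Let $\mathscr{P}\subseteq\mathbb{N}^p$ be a polymatroid, with stalactites defined using a fixed lexicographic order. For each $\mathbf{n}\in\mathbb{N}^p$, the signed number of stalactites $c'_{\mathbf{n}}(\mathscr{P})$ containing $\mathbf n$ satisfies \[c'_{\mathbf{n}}(\mathscr{P})=\begin{cases}1 & \text{if } \mathbf{n}\in B(\mathscr{P}),\\ 1-\sum_{\mathbf{m}>\mathbf{n}}c'_{\mathbf{m}}(\mathscr{P}) & \text{if } \mathbf{n}\in I(\mathscr{P})\setminus B(\mathscr{P}),\\ 0 & \text{if } \mathbf{n}\notin I(\mathscr{P}),\end{cases}\] where the sum is over $\mathbf m\in\mathbb{N}^p$ with $\mathbf m\ge\mathbf n$, $\mathbf m\neq\mathbf n$. Consequently $c'_{\mathbf{n}}(\mathscr{P})=\mu_{\mathscr{P}}(\mathbf{n})$ for all $\mathbf n\in\mathbb{N}^p$.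
   Context: Notation: $\mathbb{N}=\{0,1,2,\dots\}$, $[p]=\{1,\dots,p\}$, $\mathbf{e}_i$ is the $i$th standard basis vector, $\mathbf{e}_J=\sum_{j\in J}\mathbf{e}_j$ for $J\subseteq[p]$, $|\mathbf{n}|=n_1+\cdots+n_p$, and $\le$ is the componentwise order on $\mathbb{N}^p$. A polymatroid is a finite set $\mathscr{P}\subseteq\mathbb{N}^p$ whose elements all have the same value of $|\cdot|$, called the rank $\mathrm{rk}(\mathscr{P})$, and which is M-convex: for all $\mathbf{u},\mathbf{v}\in\mathscr{P}$ and $i$ with $u_i>v_i$ there is $j$ with $u_j<v_j$ and $\mathbf{u}-\mathbf{e}_i+\mathbf{e}_j\in\mathscr{P}$. $B(\mathscr{P})=\mathrm{conv}(\mathscr{P})$ and $I(\mathscr{P})=(B(\mathscr{P})+\mathbb{R}^p_{\le0})\cap\mathbb{R}^p_{\ge0}$. Stalactites: fix a lexicographic order $\prec$ on $\mathbb{N}^p$ (lex order with respect to some ordering of coordinates) and list $\mathscr{P}=\{\mathbf{a}_1\prec\cdots\prec\mathbf{a}_r\}$. For $\mathbf u\in\mathscr P$, $V\subseteq\mathscr P$, let $L(\mathbf u;V)$ be the set of $\ell\in[p]$ with $\mathbf u-\mathbf e_\ell+\mathbf e_j\in V$ for some $j\ne\ell$, and $\mathrm{St}(\mathbf u;V)=\{\mathbf u-\mathbf e_J:J\subseteq L(\mathbf u;V)\}$. The stalactites are $\mathrm{St}(\mathbf a_i;\{\mathbf a_1,\dots,\mathbf a_{i-1}\})$, $i=1,\dots,r$.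 Define $c'_{\mathbf n}(\mathscr P)=(-1)^{\mathrm{rk}(\mathscr P)-|\mathbf n|}\cdot\#\{i:\mathbf n\in\mathrm{St}(\mathbf a_i;\{\mathbf a_1,\dots,\mathbf a_{i-1}\})\}$. M\"obius values: let $P$ be the poset on $(I(\mathscr{P})\cap\mathbb{N}^p)\sqcup\{\hat1\}$ ordered componentwise with a new maximum $\hat 1$, with M\"obius function $\mu_P$. Set $\mu_{\mathscr P}(\mathbf n)=-\mu_P(\mathbf n,\hat1)$ for $\mathbf n\in I(\mathscr P)\cap\mathbb N^p$ and $\mu_{\mathscr P}(\mathbf n)=0$ for $\mathbf n\in\mathbb N^p\setminus I(\mathscr P)$. -}

module Defs where

open import Data.Nat as ℕ using (ℕ; zero; suc; _<_; _≤?_; _%_)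
open import Data.Integer as ℤ using (ℤ; +_; -_; ∣_∣)
open import Data.Rational as ℚ using (ℚ; 0ℚ; 1ℚ)
open import Data.Fin using (Fin; toℕ)
open import Data.Fin.Properties using (any?; all?) renaming (_≟_ to _≟ᶠ_)
open import Data.Fin.Subset using (Subset; _∈_)
open import Data.Fin.Subset.Properties using (_∈?_; anySubset?)
open import Data.Fin.Permutation using (Permutation′; _⟨$⟩ʳ_)
open import Data.Vec as Vec using (Vec; []; _∷_; lookup; tabulate; zipWith)
open import Data.Vec.Properties using (≡-dec)
open import Data.Vec.Relation.Binary.Pointwise.Inductive as PW using (Pointwise)
open import Data.List as List using (List; []; _∷_; _++_; [_]; filter; length; upTo; concatMap)
open import Data.List.Relation.Unary.Any as Any using (Any)
open import Data.List.Relation.Unary.All using (All)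
open import Data.List.Membership.Propositional renaming (_∈_ to _∈ₗ_)
open import Data.Bool using (Bool; true; false; if_then_else_)
open import Data.Maybe using (Maybe; just; nothing)
open import Data.Product using (Σ; ∃; ∃-syntax; _×_; _,_)
open import Data.Unit using (⊤)
open import Data.Empty using (⊥)
open import Relation.Nullary using (¬_; Dec; does; ¬?; _×-dec_; _→-dec_)
open import Relation.Nullary.Decidable using (⌊_⌋)
open import Relation.Binary.PropositionalEquality using (_≡_; _≢_)

Vecℕ : ℕ → Set
Vecℕ p = Vec ℕ p

_≟ᵥ_ : ∀ {p} (u v : Vecℕ p) → Dec (u ≡ v)
_≟ᵥ_ = ≡-dec ℕ._≟_

_+ᵥ_ : ∀ {p} → Vecℕ p → Vecℕ p → Vecℕ p
_+ᵥ_ = zipWith ℕ._+_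

𝐞 : ∀ {p} → Fin p → Vecℕ p
𝐞 i = tabulate (λ k → if does (k ≟ᶠ i) then 1 else 0)

𝐞ₛ : ∀ {p} → Subset p → Vecℕ p
𝐞ₛ J = tabulate (λ k → if does (k ∈? J) then 1 else 0)

∣_∣ᵥ : ∀ {p} → Vecℕ p → ℕ
∣ n ∣ᵥ = Vec.sum n

_≤ᵥ_ : ∀ {p} → Vecℕ p → Vecℕ p → Set
_≤ᵥ_ = Pointwise ℕ._≤_

_≤ᵥ?_ : ∀ {p} (u v : Vecℕ p) → Dec (u ≤ᵥ v)
_≤ᵥ?_ = PW.decidable ℕ._≤?_

box : (p K : ℕ) → List (Vecℕ p)
box zero    K = [ [] ]
box (suc p) K = concatMap (λ x → List.map (x ∷_) (box p K)) (upTo (suc K))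

-- Polymatroids (a finite set given by a duplicate-free list)

-- rank: common value of |·| (0 for the empty set, irrelevant there)
rk : ∀ {p} → List (Vecℕ p) → ℕ
rk []      = 0
rk (a ∷ _) = ∣ a ∣ᵥ

SameRank : ∀ {p} → List (Vecℕ p) → Set
SameRank P = ∀ {u v} → u ∈ₗ P → v ∈ₗ P → ∣ u ∣ᵥ ≡ ∣ v ∣ᵥ

-- M-convexity: u - e_i + e_j ∈ P written as  w + e_i ≡ u + e_j, w ∈ P
MConvex : ∀ {p} → List (Vecℕ p) → Set
MConvex {p} P = ∀ {u v} → u ∈ₗ P → v ∈ₗ P → (i : Fin p) → lookup v i < lookup u i →
  ∃[ j ] (lookup u j < lookup v j × ∃[ w ] (w ∈ₗ P × w +ᵥ 𝐞 i ≡ u +ᵥ 𝐞 j))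

IsPolymatroid : ∀ {p} → List (Vecℕ p) → Set
IsPolymatroid P = SameRank P × MConvex P

LexLt : ∀ {p} → Permutation′ p → Vecℕ p → Vecℕ p → Set
LexLt {p} σ u v = ∃[ k ] ((∀ (i : Fin p) → toℕ i < toℕ k → lookup u (σ ⟨$⟩ʳ i) ≡ lookup v (σ ⟨$⟩ʳ i))
                           × lookup u (σ ⟨$⟩ʳ k) < lookup v (σ ⟨$⟩ʳ k))

-- ℓ ∈ L(u;V): u - e_ℓ + e_j ∈ V for some j ≠ ℓ
InL : ∀ {p} → Vecℕ p → List (Vecℕ p) → Fin p → Set
InL u V ℓ = ∃[ j ] (j ≢ ℓ × Any (λ w → w +ᵥ 𝐞 ℓ ≡ u +ᵥ 𝐞 j) V)

inL? : ∀ {p} (u : Vecℕ p) (V : List (Vecℕ p)) (ℓ : Fin p) → Dec (InL u V ℓ)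
inL? u V ℓ = any? (λ j → ¬? (j ≟ᶠ ℓ) ×-dec Any.any? (λ w → (w +ᵥ 𝐞 ℓ) ≟ᵥ (u +ᵥ 𝐞 j)) V)

-- n ∈ St(u;V) = { u - e_J : J ⊆ L(u;V) }   (n = u - e_J written n + e_J ≡ u)
InSt : ∀ {p} → Vecℕ p → Vecℕ p → List (Vecℕ p) → Set
InSt n u V = ∃[ J ] ((∀ ℓ → ℓ ∈ J → InL u V ℓ) × n +ᵥ 𝐞ₛ J ≡ u)

inSt? : ∀ {p} (n u : Vecℕ p) (V : List (Vecℕ p)) → Dec (InSt n u V)
inSt? n u V = anySubset? (λ J → all? (λ ℓ → (ℓ ∈? J) →-dec inL? u V ℓ) ×-dec ((n +ᵥ 𝐞ₛ J) ≟ᵥ u))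

-- number of i with n ∈ St(a_i; {a_1,…,a_{i-1}}), for P = a_1 ≺ ⋯ ≺ a_r
stalCountFrom : ∀ {p} → Vecℕ p → List (Vecℕ p) → List (Vecℕ p) → ℕ
stalCountFrom n prev []       = 0
stalCountFrom n prev (a ∷ as) =
  (if does (inSt? n a prev) then 1 else 0) ℕ.+ stalCountFrom n (prev ++ [ a ]) as

stalCount : ∀ {p} → Vecℕ p → List (Vecℕ p) → ℕ
stalCount n P = stalCountFrom n [] P

negOnePow : ℤ → ℤ
negOnePow k = if does (∣ k ∣ % 2 ℕ.≟ 0) then + 1 else - (+ 1)

c′ : ∀ {p} → List (Vecℕ p) → Vecℕ p → ℤ
c′ P n = negOnePow ((+ rk P) ℤ.- (+ ∣ n ∣ᵥ)) ℤ.* (+ stalCount n P)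

sumℤ : List ℤ → ℤ
sumℤ = List.foldr ℤ._+_ (+ 0)

-- Σ_{m ≥ n, m ≠ n} c'_m(P), m ranging over the box {0,…,rk P}^p
-- (every stalactite lies below some a_i, whose coordinates are ≤ rk P)
sumAbove : ∀ {p} → List (Vecℕ p) → Vecℕ p → ℤ
sumAbove {p} P n =
  sumℤ (List.map (c′ P) (filter (λ m → (n ≤ᵥ? m) ×-dec ¬? (m ≟ᵥ n)) (box p (rk P))))

-- B(P) = conv(P) and I(P) = (B(P) + ℝ^p_{≤0}) ∩ ℝ^p_{≥0}, tested on lattice points
-- (convex combinations with rational coefficients)

sumℚ : List ℚ → ℚ
sumℚ = List.foldr ℚ._+_ 0ℚ

ℕ→ℚ : ℕ → ℚ
ℕ→ℚ k = + k ℚ./ 1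

combCoord : ∀ {p} → List ℚ → List (Vecℕ p) → Fin p → ℚ
combCoord ws P k = sumℚ (List.zipWith (λ w a → w ℚ.* ℕ→ℚ (lookup a k)) ws P)

IsConvWeights : ∀ {p} → List (Vecℕ p) → List ℚ → Set
IsConvWeights P ws = length ws ≡ length P × All (0ℚ ℚ.≤_) ws × sumℚ ws ≡ 1ℚ

InB : ∀ {p} → List (Vecℕ p) → Vecℕ p → Set
InB P n = ∃[ ws ] (IsConvWeights P ws × (∀ k → combCoord ws P k ≡ ℕ→ℚ (lookup n k)))

-- n ∈ I(P) for n ∈ ℕ^p: n ≤ b for some b ∈ B(P) (n ≥ 0 holds automatically)
InI : ∀ {p} → List (Vecℕ p) → Vecℕ p → Set
InI P n = ∃[ ws ] (IsConvWeights P ws × (∀ k → ℕ→ℚ (lookup n k) ℚ.≤ combCoord ws P k))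

-- Finite sums over a (not necessarily decidable) sub-predicate of a list,
-- as a relation: SumWhere Q f xs s  ⇔  s = Σ_{x ∈ xs, Q x} f x

data SumWhere {A : Set} (Q : A → Set) (f : A → ℤ) : List A → ℤ → Set where
  sw-[]  : SumWhere Q f [] (+ 0)
  sw-yes : ∀ {x xs s} → Q x → SumWhere Q f xs s → SumWhere Q f (x ∷ xs) (f x ℤ.+ s)
  sw-no  : ∀ {x xs s} → ¬ Q x → SumWhere Q f xs s → SumWhere Q f (x ∷ xs) s

-- The poset P̂ = (I(P) ∩ ℕ^p) ⊔ {1̂}; nothing plays the role of 1̂

Elt : ℕ → Set
Elt p = Maybe (Vecℕ p)

Carrier : ∀ {p} → List (Vecℕ p) → Elt p → Set
Carrier P (just n) = InI P n
Carrier P nothing  = ⊤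

_≤̂_ : ∀ {p} → Elt p → Elt p → Set
just m  ≤̂ just n  = m ≤ᵥ n
_       ≤̂ nothing = ⊤
nothing ≤̂ just _  = ⊥

-- a list containing every element of P̂ exactly once (together with
-- lattice points outside I(P), which the carrier predicate discards)
enumElt : ∀ {p} → List (Vecℕ p) → List (Elt p)
enumElt {p} P = nothing ∷ List.map just (box p (rk P))

IsMobius : ∀ {p} → List (Vecℕ p) → (Elt p → Elt p → ℤ) → Set
IsMobius {p} P μ = ∀ (x y : Elt p) → Carrier P x → Carrier P y → x ≤̂ y →
    (x ≡ y → μ x y ≡ + 1)
  × (x ≢ y → ∀ s → SumWhere (λ z → Carrier P z × x ≤̂ z × z ≤̂ y × z ≢ y) (μ x) (enumElt P) s
             → μ x y ≡ - s)

{-# OPTIONS --safe #-}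
module Submission where

-- A stalactite St(a;V) is a box: m_ℓ = a_ℓ, or m_ℓ ∈ {a_ℓ − 1, a_ℓ} when ℓ ∈ L(a;V). So the signed count
-- Σ_{m ≥ n} (−1)^(|a|−|m|) [m ∈ St(a;V)] factorises over the coordinates; it is 1 if n ≤ a and n_ℓ = a_ℓ on
-- L(a;V), and 0 otherwise. Along the lexicographic order this happens for the first a_i ≥ n and for no other
-- a_i: at the first one, an exchange a_i − e_ℓ + e_j among a_1,…,a_(i−1) with n_ℓ < (a_i)_ℓ would dominate n;
-- at a later one, exchanging a_i towards an earlier b ≥ n at their first difference yields such an ℓ with
-- n_ℓ ≤ b_ℓ < (a_i)_ℓ. Hence Σ_{m ≥ n} c'_m is 1 if some a ∈ P dominates n, and 0 otherwise.
-- The lattice points of I(P) are exactly those dominated by P: they satisfy x(S) ≤ max_{b∈P} b(S) for all S,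
-- and growing a point one unit vector at a time, an exchange-closed tight set shows that a point satisfying
-- these inequalities stays dominated. So c'_n vanishes off I(P) and its upward sums are 1 on I(P). This gives
-- the middle case, the first case (points strictly above B(P) have |m| > rk P, so lie outside I(P)), and,
-- by Möbius inversion on I(P) ∪ {1̂}, c'_n = −μ(n, 1̂).

open import Defs
open import Data.Fin.Permutation using (Permutation′)
open import Data.Integer using (ℤ)
open import Data.List using (List)
open import Data.List.Relation.Unary.AllPairs using (AllPairs)
open import Data.Nat using (ℕ)
open import Data.Vec using (lookup)
open import Relation.Nullary using (Dec)

module Coordinates where

  open import Data.Bool using (true; false; if_then_else_)
  open import Data.Fin using (Fin)
  open import Data.Fin.Properties using () renaming (_≟_ to _≟ᶠ_)
  open import Data.Fin.Subset using (Subset)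
  open import Data.Fin.Subset.Properties using (_∈?_)
  open import Data.Nat using (ℕ; suc; _+_; _∸_; _≤_; _<_; z≤n)
  import Data.Nat.Properties as ℕₚ
  open import Data.Product using (∃-syntax; _,_)
  open import Data.Vec using (lookup; tabulate)
  open import Data.Vec.Properties using (lookup-zipWith; lookup∘tabulate; lookup⇒[]=; []=⇒lookup)
  open import Data.Vec.Relation.Binary.Pointwise.Inductive as Pointwise using (Pointwise-≡⇒≡)
  open import Data.Vec.Relation.Binary.Pointwise.Extensional using (ext; extensional⇒inductive)
  open import Relation.Nullary using (yes; no; does)
  open import Relation.Nullary.Decidable using (dec-true; dec-false)
  open import Relation.Binary.PropositionalEquality
  open import Function using (_∘_; case_of_)

  private variable
    p : ℕ
    u v w a : Vecℕ p
    i j t : Fin p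

  δ : Fin p → Fin p → ℕ
  δ i t = if does (t ≟ᶠ i) then 1 else 0

  δ-diag : ∀ (i : Fin p) → δ i i ≡ 1
  δ-diag i = cong (if_then 1 else 0) (dec-true (i ≟ᶠ i) refl)

  δ-off : t ≢ i → δ i t ≡ 0
  δ-off {t = t} {i = i} t≢i = cong (if_then 1 else 0) (dec-false (t ≟ᶠ i) t≢i)

  lookup-+ᵥ : ∀ (u v : Vecℕ p) t → lookup (u +ᵥ v) t ≡ lookup u t + lookup v t
  lookup-+ᵥ u v t = lookup-zipWith _ t u v

  lookup-𝐞 : ∀ (i t : Fin p) → lookup (𝐞 i) t ≡ δ i t
  lookup-𝐞 i t = lookup∘tabulate _ t

  lookup-𝐞ₛ : ∀ (J : Subset p) t → lookup (𝐞ₛ J) t ≡ (if lookup J t then 1 else 0)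
  lookup-𝐞ₛ J t = trans (lookup∘tabulate _ t) (cong (if_then 1 else 0) (does-∈? (lookup J t) refl))
    where
    does-∈? : ∀ b → lookup J t ≡ b → does (t ∈? J) ≡ b
    does-∈? true  e = dec-true (t ∈? J) (lookup⇒[]= t J e)
    does-∈? false e = dec-false (t ∈? J) (λ t∈J → case trans (sym ([]=⇒lookup t∈J)) e of λ ())

  lookup-+ᵥ𝐞ₛ : ∀ (v : Vecℕ p) (J : Subset p) t → lookup (v +ᵥ 𝐞ₛ J) t ≡ lookup v t + (if lookup J t then 1 else 0)
  lookup-+ᵥ𝐞ₛ v J t = trans (lookup-+ᵥ v (𝐞ₛ J) t) (cong (lookup v t +_) (lookup-𝐞ₛ J t))

  ≡-fromLookup : (∀ t → lookup u t ≡ lookup v t) → u ≡ v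
  ≡-fromLookup h = Pointwise-≡⇒≡ (extensional⇒inductive (ext h))

  ≤ᵥ-fromLookup : (∀ t → lookup u t ≤ lookup v t) → u ≤ᵥ v
  ≤ᵥ-fromLookup h = extensional⇒inductive (ext h)

  ≤ᵥ-lookup : u ≤ᵥ v → ∀ t → lookup u t ≤ lookup v t
  ≤ᵥ-lookup = Pointwise.lookup

  ≤ᵥ-refl : u ≤ᵥ u
  ≤ᵥ-refl = Pointwise.refl ℕₚ.≤-refl

  ≤ᵥ-trans : u ≤ᵥ v → v ≤ᵥ w → u ≤ᵥ w
  ≤ᵥ-trans = Pointwise.trans ℕₚ.≤-trans

  ≤ᵥ-antisym : u ≤ᵥ v → v ≤ᵥ u → u ≡ v
  ≤ᵥ-antisym u≤v v≤u = ≡-fromLookup λ t → ℕₚ.≤-antisym (≤ᵥ-lookup u≤v t) (≤ᵥ-lookup v≤u t)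

  lookup-+ᵥ𝐞 : ∀ (v : Vecℕ p) k t → lookup (v +ᵥ 𝐞 k) t ≡ lookup v t + δ k t
  lookup-+ᵥ𝐞 v k t = trans (lookup-+ᵥ v (𝐞 k) t) (cong (lookup v t +_) (lookup-𝐞 k t))

  lookup-+ᵥ𝐞-diag : ∀ (v : Vecℕ p) k → lookup (v +ᵥ 𝐞 k) k ≡ suc (lookup v k)
  lookup-+ᵥ𝐞-diag v k = trans (lookup-+ᵥ𝐞 v k k) (trans (cong (lookup v k +_) (δ-diag k)) (ℕₚ.+-comm _ 1))

  lookup-+ᵥ𝐞-off : ∀ (v : Vecℕ p) {k t} → t ≢ k → lookup (v +ᵥ 𝐞 k) t ≡ lookup v t
  lookup-+ᵥ𝐞-off v {k} {t} t≢k = trans (lookup-+ᵥ𝐞 v k t) (trans (cong (lookup v t +_) (δ-off t≢k)) (ℕₚ.+-identityʳ _))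

  ≤ᵥ-+ᵥ𝐞 : ∀ (v : Vecℕ p) k → v ≤ᵥ (v +ᵥ 𝐞 k)
  ≤ᵥ-+ᵥ𝐞 v k = ≤ᵥ-fromLookup λ t → subst (lookup v t ≤_) (sym (lookup-+ᵥ𝐞 v k t)) (ℕₚ.m≤m+n _ _)

  +ᵥ𝐞-≤ᵥ : ∀ {k} → v ≤ᵥ w → lookup v k < lookup w k → (v +ᵥ 𝐞 k) ≤ᵥ w
  +ᵥ𝐞-≤ᵥ {v = v} {w = w} {k} v≤w vk<wk = ≤ᵥ-fromLookup bound
    where
    bound : ∀ t → lookup (v +ᵥ 𝐞 k) t ≤ lookup w t
    bound t with t ≟ᶠ k
    ... | yes refl = subst (_≤ lookup w t) (sym (lookup-+ᵥ𝐞-diag v t)) vk<wk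
    ... | no t≢k   = subst (_≤ lookup w t) (sym (lookup-+ᵥ𝐞-off v t≢k)) (≤ᵥ-lookup v≤w t)

  remove-unit : ∀ (m : Vecℕ p) k → 0 < lookup m k → ∃[ m′ ] (m′ +ᵥ 𝐞 k ≡ m)
  remove-unit {p} m k pos = m′ , ≡-fromLookup restore
    where
    m′ : Vecℕ p
    m′ = tabulate (λ t → lookup m t ∸ δ k t)
    δ≤m : ∀ t → δ k t ≤ lookup m t
    δ≤m t with t ≟ᶠ k
    ... | yes refl = pos
    ... | no _     = z≤n
    restore : ∀ t → lookup (m′ +ᵥ 𝐞 k) t ≡ lookup m t
    restore t = trans (lookup-+ᵥ𝐞 m′ k t)
                  (trans (cong (_+ δ k t) (lookup∘tabulate _ t)) (ℕₚ.m∸n+n≡m (δ≤m t)))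

  exchange-lookup : w +ᵥ 𝐞 i ≡ a +ᵥ 𝐞 j → ∀ t → lookup w t + δ i t ≡ lookup a t + δ j t
  exchange-lookup {w = w} {i = i} {a = a} {j = j} eq t =
    trans (sym (lookup-+ᵥ𝐞 w i t)) (trans (cong (λ x → lookup x t) eq) (lookup-+ᵥ𝐞 a j t))

  exchange-≤ : w +ᵥ 𝐞 i ≡ a +ᵥ 𝐞 j → t ≢ j → lookup w t ≤ lookup a t
  exchange-≤ {w = w} {i = i} {a = a} {j = j} {t = t} eq t≢j = begin
    lookup w t         ≤⟨ ℕₚ.m≤m+n _ _ ⟩
    lookup w t + δ i t ≡⟨ exchange-lookup eq t ⟩
    lookup a t + δ j t ≡⟨ cong (lookup a t +_) (δ-off t≢j) ⟩
    lookup a t + 0     ≡⟨ ℕₚ.+-identityʳ _ ⟩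
    lookup a t         ∎
    where open ℕₚ.≤-Reasoning

  exchange-≥ : w +ᵥ 𝐞 i ≡ a +ᵥ 𝐞 j → t ≢ i → lookup a t ≤ lookup w t
  exchange-≥ {w = w} {i = i} {a = a} {j = j} {t = t} eq t≢i = begin
    lookup a t         ≤⟨ ℕₚ.m≤m+n _ _ ⟩
    lookup a t + δ j t ≡⟨ exchange-lookup eq t ⟨
    lookup w t + δ i t ≡⟨ cong (lookup w t +_) (δ-off t≢i) ⟩
    lookup w t + 0     ≡⟨ ℕₚ.+-identityʳ _ ⟩
    lookup w t         ∎
    where open ℕₚ.≤-Reasoning

  exchange-source : w +ᵥ 𝐞 i ≡ a +ᵥ 𝐞 j → i ≢ j → suc (lookup w i) ≡ lookup a i
  exchange-source {w = w} {i = i} {a = a} {j = j} eq i≢j = begin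
    suc (lookup w i)   ≡⟨ ℕₚ.+-comm 1 (lookup w i) ⟩
    lookup w i + 1     ≡⟨ cong (lookup w i +_) (δ-diag i) ⟨
    lookup w i + δ i i ≡⟨ exchange-lookup eq i ⟩
    lookup a i + δ j i ≡⟨ cong (lookup a i +_) (δ-off i≢j) ⟩
    lookup a i + 0     ≡⟨ ℕₚ.+-identityʳ _ ⟩
    lookup a i         ∎
    where open ≡-Reasoning

  exchange-target : w +ᵥ 𝐞 i ≡ a +ᵥ 𝐞 j → i ≢ j → lookup w j ≡ suc (lookup a j)
  exchange-target {w = w} {i = i} {a = a} {j = j} eq i≢j = begin
    lookup w j         ≡⟨ ℕₚ.+-identityʳ _ ⟨
    lookup w j + 0     ≡⟨ cong (lookup w j +_) (δ-off (i≢j ∘ sym)) ⟨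
    lookup w j + δ i j ≡⟨ exchange-lookup eq j ⟩
    lookup a j + δ j j ≡⟨ cong (lookup a j +_) (δ-diag j) ⟩
    lookup a j + 1     ≡⟨ ℕₚ.+-comm (lookup a j) 1 ⟩
    suc (lookup a j)   ∎
    where open ≡-Reasoning

  exchange-other : w +ᵥ 𝐞 i ≡ a +ᵥ 𝐞 j → t ≢ i → t ≢ j → lookup w t ≡ lookup a t
  exchange-other {w = w} {i = i} {a = a} {j = j} {t = t} eq t≢i t≢j = begin
    lookup w t         ≡⟨ ℕₚ.+-identityʳ _ ⟨
    lookup w t + 0     ≡⟨ cong (lookup w t +_) (δ-off t≢i) ⟨
    lookup w t + δ i t ≡⟨ exchange-lookup eq t ⟩
    lookup a t + δ j t ≡⟨ cong (lookup a t +_) (δ-off t≢j) ⟩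
    lookup a t + 0     ≡⟨ ℕₚ.+-identityʳ _ ⟩
    lookup a t         ∎
    where open ≡-Reasoning

module NatSums where

  open import Data.Bool using (Bool; true; false; if_then_else_; not)
  open import Data.Fin using (Fin; zero; suc)
  open import Data.Nat using (ℕ; zero; suc; _+_; _∸_; _≤_; _<_; z≤n)
  import Data.Nat.Properties as ℕₚ
  open import Data.Fin.Properties using (¬∀⟶∃¬)
  open import Data.Product using (_,_)
  open import Data.Vec using ([]; _∷_; lookup)
  open import Function using (_∘_)
  open import Relation.Binary.PropositionalEquality
  open import Algebra.Properties.Semiring.Sum ℕₚ.+-*-semiring public using (sum; sum-cong-≗)
  open import Algebra.Properties.Semiring.Sum ℕₚ.+-*-semiring using (∑-distrib-+)
  open Coordinates

  private variable
    p : ℕ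

  ∣∣ᵥ≡sum : ∀ (v : Vecℕ p) → ∣ v ∣ᵥ ≡ sum (lookup v)
  ∣∣ᵥ≡sum []      = refl
  ∣∣ᵥ≡sum (x ∷ v) = cong (x +_) (∣∣ᵥ≡sum v)

  sum-mono-≤ : ∀ {f g : Fin p → ℕ} → (∀ t → f t ≤ g t) → sum f ≤ sum g
  sum-mono-≤ {zero}  f≤g = z≤n
  sum-mono-≤ {suc p} f≤g = ℕₚ.+-mono-≤ (f≤g zero) (sum-mono-≤ (f≤g ∘ suc))

  sum-mono-< : ∀ {f g : Fin p → ℕ} → (∀ t → f t ≤ g t) → ∀ ℓ → f ℓ < g ℓ → sum f < sum g
  sum-mono-< {suc p} f≤g zero    f<g = ℕₚ.+-mono-<-≤ f<g (sum-mono-≤ (λ t → f≤g (suc t)))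
  sum-mono-< {suc p} f≤g (suc ℓ) f<g = ℕₚ.+-mono-≤-< (f≤g zero) (sum-mono-< (λ t → f≤g (suc t)) ℓ f<g)

  mask : (Fin p → Bool) → Vecℕ p → Fin p → ℕ
  mask S v t = if S t then lookup v t else 0

  weight : (Fin p → Bool) → Vecℕ p → ℕ
  weight S v = sum (mask S v)

  ∣∣ᵥ-split : ∀ (S : Fin p → Bool) v → ∣ v ∣ᵥ ≡ weight S v + weight (not ∘ S) v
  ∣∣ᵥ-split S v = trans (∣∣ᵥ≡sum v) (trans (sum-cong-≗ split) (∑-distrib-+ (mask S v) (mask (not ∘ S) v)))
    where
    split : ∀ t → lookup v t ≡ mask S v t + mask (not ∘ S) v t
    split t with S t
    ... | true  = sym (ℕₚ.+-identityʳ _)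
    ... | false = refl

  ∣∣ᵥ-mono-≤ : ∀ {u v : Vecℕ p} → u ≤ᵥ v → ∣ u ∣ᵥ ≤ ∣ v ∣ᵥ
  ∣∣ᵥ-mono-≤ {u = u} {v} u≤v = subst₂ _≤_ (sym (∣∣ᵥ≡sum u)) (sym (∣∣ᵥ≡sum v)) (sum-mono-≤ (≤ᵥ-lookup u≤v))

  ∣∣ᵥ-mono-< : ∀ {u v : Vecℕ p} → u ≤ᵥ v → u ≢ v → ∣ u ∣ᵥ < ∣ v ∣ᵥ
  ∣∣ᵥ-mono-< {p} {u} {v} u≤v u≢v with ¬∀⟶∃¬ p (λ t → lookup u t ≡ lookup v t) (λ t → lookup u t ℕₚ.≟ lookup v t) (u≢v ∘ ≡-fromLookup)
  ... | t , ut≢vt = subst₂ _<_ (sym (∣∣ᵥ≡sum u)) (sym (∣∣ᵥ≡sum v))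
                      (sum-mono-< (≤ᵥ-lookup u≤v) t (ℕₚ.≤∧≢⇒< (≤ᵥ-lookup u≤v t) ut≢vt))

  lookup≤∣∣ᵥ : ∀ (v : Vecℕ p) k → lookup v k ≤ ∣ v ∣ᵥ
  lookup≤∣∣ᵥ (x ∷ v) zero    = ℕₚ.m≤m+n x _
  lookup≤∣∣ᵥ (x ∷ v) (suc k) = ℕₚ.≤-trans (lookup≤∣∣ᵥ v k) (ℕₚ.m≤n+m _ x)

  mask-mono : ∀ S (u v : Vecℕ p) t → lookup u t ≤ lookup v t → mask S u t ≤ mask S v t
  mask-mono S u v t ut≤vt with S t
  ... | true  = ut≤vt
  ... | false = z≤n

  weight-mono : ∀ S {u v : Vecℕ p} → u ≤ᵥ v → weight S u ≤ weight S v
  weight-mono S {u} {v} u≤v = sum-mono-≤ λ t → mask-mono S u v t (≤ᵥ-lookup u≤v t)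

  weight-+ᵥ𝐞 : ∀ {S} (v : Vecℕ p) {k} → S k ≡ true → weight S v < weight S (v +ᵥ 𝐞 k)
  weight-+ᵥ𝐞 {S = S} v {k} Sk = sum-mono-< (λ t → mask-mono S v (v +ᵥ 𝐞 k) t (≤ᵥ-lookup (≤ᵥ-+ᵥ𝐞 v k) t)) k strict
    where
    strict : mask S v k < mask S (v +ᵥ 𝐞 k) k
    strict rewrite Sk = ℕₚ.≤-reflexive (sym (lookup-+ᵥ𝐞-diag v k))

  ∣∣ᵥ-∸ : ∀ {u v : Vecℕ p} → u ≤ᵥ v → sum (λ t → lookup v t ∸ lookup u t) ≡ ∣ v ∣ᵥ ∸ ∣ u ∣ᵥ
  ∣∣ᵥ-∸ {p} {u} {v} u≤v = begin
    sum gap                        ≡⟨ ℕₚ.m+n∸n≡m (sum gap) ∣ u ∣ᵥ ⟨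
    sum gap + ∣ u ∣ᵥ ∸ ∣ u ∣ᵥ      ≡⟨ cong (λ s → sum gap + s ∸ ∣ u ∣ᵥ) (∣∣ᵥ≡sum u) ⟩
    sum gap + sum (lookup u) ∸ ∣ u ∣ᵥ ≡⟨ cong (_∸ ∣ u ∣ᵥ) (∑-distrib-+ gap (lookup u)) ⟨
    sum (λ t → gap t + lookup u t) ∸ ∣ u ∣ᵥ ≡⟨ cong (_∸ ∣ u ∣ᵥ) (sum-cong-≗ λ t → ℕₚ.m∸n+n≡m (≤ᵥ-lookup u≤v t)) ⟩
    sum (lookup v) ∸ ∣ u ∣ᵥ        ≡⟨ cong (_∸ ∣ u ∣ᵥ) (∣∣ᵥ≡sum v) ⟨
    ∣ v ∣ᵥ ∸ ∣ u ∣ᵥ                ∎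
    where
    open ≡-Reasoning
    gap : Fin p → ℕ
    gap t = lookup v t ∸ lookup u t

module Polymatroids where

  open import Data.Bool as Bool using (Bool; true; false; not)
  open import Data.Empty using (⊥; ⊥-elim)
  open import Data.Fin using (Fin)
  open import Data.Fin.Properties using (any?) renaming (_≟_ to _≟ᶠ_)
  open import Data.List using (List; _∷_)
  open import Data.List.Membership.Propositional using (_∈_; find; lose)
  open import Data.List.Relation.Unary.Any as Any using (Any; here)
  open import Data.Nat using (ℕ; _∸_; _≤_; _<_; _<?_; z≤n; s≤s; _+_)
  open import Data.Nat.Induction using (<-wellFounded)
  import Data.Nat.Properties as ℕₚ
  open import Data.Product using (∃-syntax; _×_; _,_)
  open import Data.Sum using (_⊎_; inj₁; inj₂)
  open import Data.Vec using (lookup)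
  open import Function using (_∘_)
  open import Induction.WellFounded using (Acc; acc)
  open import Relation.Binary.PropositionalEquality
  open import Relation.Nullary using (¬_; Dec; yes; no; does; _×-dec_; _⊎-dec_)
  open import Relation.Nullary.Decidable using (dec-true)
  open Coordinates
  open NatSums

  private

    does-true : ∀ {A : Set} (d : Dec A) → does d ≡ true → A
    does-true (yes a) _ = a

    does-false : ∀ {A : Set} (d : Dec A) → does d ≡ false → ¬ A
    does-false (no ¬a) _ = ¬a

  RankBounded : ∀ {p} → List (Vecℕ p) → Vecℕ p → Set
  RankBounded P m = ∀ S c → (∀ {b} → b ∈ P → weight S b ≤ c) → weight S m ≤ c

  sameRank⇒rk≡∣∣ᵥ : ∀ {p} {P : List (Vecℕ p)} → SameRank P → ∀ {a} → a ∈ P → rk P ≡ ∣ a ∣ᵥ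
  sameRank⇒rk≡∣∣ᵥ {P = b ∷ _} sameRank a∈P = sameRank (here refl) a∈P

  module _ {p : ℕ} (P : List (Vecℕ p)) (sameRank : SameRank P) (mConvex : MConvex P) where

    private variable
      a b n u v : Vecℕ p
      i j k ℓ : Fin p
      S : Fin p → Bool

    ExchangeClosed : Vecℕ p → (Fin p → Bool) → Set
    ExchangeClosed a S = ∀ {i j w} → S i ≡ false → S j ≡ true → w ∈ P → w +ᵥ 𝐞 i ≡ a +ᵥ 𝐞 j → ⊥

    excess : Vecℕ p → Vecℕ p → ℕ
    excess a b = sum (λ t → lookup b t ∸ lookup a t)

    exchange-descent : a ∈ P → b ∈ P → S ℓ ≡ false → lookup a ℓ < lookup b ℓ →
      ∃[ w ] (w ∈ P × weight S b ≤ weight S w × excess a w < excess a b)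
    exchange-descent {a} {b} {S} {ℓ} aP bP Sℓ aℓ<bℓ with mConvex bP aP ℓ aℓ<bℓ
    ... | j , bj<aj , w , wP , w≡ = w , wP , sum-mono-≤ heavier , sum-mono-< closer ℓ strictly-closer
      where
      ℓ≢j : ℓ ≢ j
      ℓ≢j refl = ℕₚ.<-asym aℓ<bℓ bj<aj
      heavier : ∀ t → mask S b t ≤ mask S w t
      heavier t with t ≟ᶠ ℓ
      ... | yes refl rewrite Sℓ = z≤n
      ... | no t≢ℓ = mask-mono S b w t (exchange-≥ w≡ t≢ℓ)
      closer : ∀ t → lookup w t ∸ lookup a t ≤ lookup b t ∸ lookup a t
      closer t with t ≟ᶠ j
      ... | yes refl = ℕₚ.≤-trans (ℕₚ.≤-reflexive (ℕₚ.m≤n⇒m∸n≡0 wj≤aj)) z≤n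
        where
        wj≤aj : lookup w t ≤ lookup a t
        wj≤aj = subst (_≤ lookup a t) (sym (exchange-target w≡ ℓ≢j)) bj<aj
      ... | no t≢j = ℕₚ.∸-monoˡ-≤ (lookup a t) (exchange-≤ w≡ t≢j)
      strictly-closer : lookup w ℓ ∸ lookup a ℓ < lookup b ℓ ∸ lookup a ℓ
      strictly-closer = ℕₚ.∸-monoˡ-< wℓ<bℓ (ℕₚ.≤-pred (subst (lookup a ℓ <_) (sym (exchange-source w≡ ℓ≢j)) aℓ<bℓ))
        where
        wℓ<bℓ : lookup w ℓ < lookup b ℓ
        wℓ<bℓ = subst (lookup w ℓ <_) (exchange-source w≡ ℓ≢j) (ℕₚ.n<1+n _)

    weight-agree : a ∈ P → b ∈ P → (∀ t → S t ≡ false → lookup b t ≡ lookup a t) → weight S b ≡ weight S a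
    weight-agree {a} {b} {S} aP bP agree = ℕₚ.+-cancelʳ-≡ _ (weight S b) (weight S a) (begin
      weight S b + weight (not ∘ S) a ≡⟨ cong (weight S b +_) (sum-cong-≗ agree′) ⟨
      weight S b + weight (not ∘ S) b ≡⟨ ∣∣ᵥ-split S b ⟨
      ∣ b ∣ᵥ                          ≡⟨ sameRank bP aP ⟩
      ∣ a ∣ᵥ                          ≡⟨ ∣∣ᵥ-split S a ⟩
      weight S a + weight (not ∘ S) a ∎)
      where
      open ≡-Reasoning
      agree′ : ∀ t → mask (not ∘ S) b t ≡ mask (not ∘ S) a t
      agree′ t with S t in St
      ... | true  = refl
      ... | false = agree t St

    -- Induction on the excess of b over a: exchanging b towards a at a coordinate outside S never
    -- lowers its S-weight, and once no such coordinate is left, closedness makes b agree with a outside S.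
    exchangeClosed⇒maximal : a ∈ P → ExchangeClosed a S → b ∈ P → weight S b ≤ weight S a
    exchangeClosed⇒maximal {a} {S} aP closed bP = go bP (<-wellFounded _)
      where
      go : ∀ {b} → b ∈ P → Acc _<_ (excess a b) → weight S b ≤ weight S a
      go {b} bP (acc rec) with any? (λ ℓ → (S ℓ Bool.≟ false) ×-dec (lookup a ℓ <? lookup b ℓ))
      ... | yes (ℓ , Sℓ , aℓ<bℓ) with exchange-descent aP bP Sℓ aℓ<bℓ
      ...   | w , wP , b≤w , w-closer = ℕₚ.≤-trans b≤w (go wP (rec w-closer))
      go {b} bP _ | no no-descent = ℕₚ.≤-reflexive (weight-agree aP bP agree)
        where
        agree : ∀ t → S t ≡ false → lookup b t ≡ lookup a t
        agree t St = ℕₚ.≤-antisym (ℕₚ.≮⇒≥ (λ at<bt → no-descent (t , St , at<bt))) (ℕₚ.≮⇒≥ bt≮at)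
          where
          bt≮at : ¬ lookup b t < lookup a t
          bt≮at bt<at with mConvex aP bP t bt<at
          ... | j , aj<bj , w , wP , w≡ with S j in Sj
          ...   | true  = closed St Sj wP w≡
          ...   | false = no-descent (j , Sj , aj<bj)

    exchange-trans : ∀ {u v} → u ∈ P → v ∈ P → u +ᵥ 𝐞 i ≡ a +ᵥ 𝐞 j → v +ᵥ 𝐞 j ≡ a +ᵥ 𝐞 k →
      i ≢ j → i ≢ k → ∃[ w ] (w ∈ P × w +ᵥ 𝐞 i ≡ a +ᵥ 𝐞 k)
    exchange-trans {i} {a} {j} {k} {u} {v} uP vP u≡ v≡ i≢j i≢k with mConvex vP uP i ui<vi
      where
      ui<vi : lookup u i < lookup v i
      ui<vi = subst (lookup u i <_) (trans (exchange-source u≡ i≢j) (sym (exchange-other v≡ i≢j i≢k))) (ℕₚ.n<1+n _)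
    ... | t , vt<ut , w , wP , w≡ with t ≟ᶠ j
    ...   | yes refl = w , wP , trans w≡ v≡
    ...   | no t≢j   = ⊥-elim (ℕₚ.<-irrefl refl (ℕₚ.<-≤-trans vt<ut (ℕₚ.≤-trans (exchange-≤ u≡ t≢j) (exchange-≥ v≡ t≢j))))

    Feeds : Vecℕ p → Fin p → Fin p → Set
    Feeds a k i = i ≡ k ⊎ Any (λ w → w +ᵥ 𝐞 i ≡ a +ᵥ 𝐞 k) P

    feeds? : ∀ a k i → Dec (Feeds a k i)
    feeds? a k i = (i ≟ᶠ k) ⊎-dec Any.any? (λ w → (w +ᵥ 𝐞 i) ≟ᵥ (a +ᵥ 𝐞 k)) P

    feeders : Vecℕ p → Fin p → Fin p → Bool
    feeders a k i = does (feeds? a k i)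

    feeders-closed : ∀ a k → ExchangeClosed a (feeders a k)
    feeders-closed a k {i} {j} {w} i∉S j∈S wP w≡ = does-false (feeds? a k i) i∉S (inj₂ (reach (does-true (feeds? a k j) j∈S)))
      where
      i≢j : i ≢ j
      i≢j refl with () ← trans (sym i∉S) j∈S
      reach : Feeds a k j → Any (λ w → w +ᵥ 𝐞 i ≡ a +ᵥ 𝐞 k) P
      reach (inj₁ refl) = lose wP w≡
      reach (inj₂ j-feeds) with find j-feeds
      ... | v , vP , v≡ with exchange-trans wP vP w≡ v≡ i≢j (does-false (feeds? a k i) i∉S ∘ inj₁)
      ...   | w′ , w′P , w′≡ = lose w′P w′≡

    feeders-tight : a ∈ P → n ≤ᵥ a → (∀ {w} → w ∈ P → n ≤ᵥ w → lookup w k ≤ lookup n k) →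
      ∀ t → Feeds a k t → lookup a t ≡ lookup n t
    feeders-tight {a} {n} {k} aP n≤a capped t t-feeds with t ≟ᶠ k | t-feeds
    ... | yes refl | _               = ak≡nk
      where
      ak≡nk : lookup a t ≡ lookup n t
      ak≡nk = ℕₚ.≤-antisym (capped aP n≤a) (≤ᵥ-lookup n≤a t)
    ... | no t≢k   | inj₁ t≡k       = ⊥-elim (t≢k t≡k)
    ... | no t≢k   | inj₂ t-exchange with find t-exchange
    ...   | v , vP , v≡ = ℕₚ.≤-antisym (ℕₚ.≮⇒≥ nt≮at) (≤ᵥ-lookup n≤a t)
      where
      nt≮at : ¬ lookup n t < lookup a t
      nt≮at nt<at = ℕₚ.<-irrefl refl (ℕₚ.<-≤-trans (s≤s (≤ᵥ-lookup n≤a k))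
                                                   (subst (_≤ lookup n k) (exchange-target v≡ t≢k) (capped vP n≤v)))
        where
        n≤v : n ≤ᵥ v
        n≤v = ≤ᵥ-fromLookup λ s → below s (s ≟ᶠ t)
          where
          below : ∀ s → Dec (s ≡ t) → lookup n s ≤ lookup v s
          below s (yes refl) = ℕₚ.≤-pred (subst (lookup n s <_) (sym (exchange-source v≡ t≢k)) nt<at)
          below s (no s≢t)   = ℕₚ.≤-trans (≤ᵥ-lookup n≤a s) (exchange-≥ v≡ s≢t)

    tightSet : a ∈ P → n ≤ᵥ a → (∀ {w} → w ∈ P → n ≤ᵥ w → lookup w k ≤ lookup n k) →
      ∃[ S ] (S k ≡ true × (∀ {b} → b ∈ P → weight S b ≤ weight S n))
    tightSet {a} {n} {k} aP n≤a capped =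
      feeders a k , dec-true (feeds? a k k) (inj₁ refl) ,
      λ {b} bP → subst (weight (feeders a k) b ≤_) (sum-cong-≗ a≐n) (exchangeClosed⇒maximal aP (feeders-closed a k) bP)
      where
      a≐n : ∀ t → mask (feeders a k) a t ≡ mask (feeders a k) n t
      a≐n t with feeders a k t in t∈S
      ... | true  = feeders-tight aP n≤a capped t (does-true (feeds? a k t) t∈S)
      ... | false = refl

    rankBounded-mono : u ≤ᵥ v → RankBounded P v → RankBounded P u
    rankBounded-mono u≤v bounded S c max = ℕₚ.≤-trans (weight-mono S u≤v) (bounded S c max)

    ¬rankBounded-+ᵥ𝐞 : a ∈ P → n ≤ᵥ a → ¬ Any ((n +ᵥ 𝐞 k) ≤ᵥ_) P → ¬ RankBounded P (n +ᵥ 𝐞 k)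
    ¬rankBounded-+ᵥ𝐞 {a} {n} {k} aP n≤a undominated bounded with tightSet aP n≤a capped
      where
      capped : ∀ {w} → w ∈ P → n ≤ᵥ w → lookup w k ≤ lookup n k
      capped wP n≤w = ℕₚ.≮⇒≥ λ nk<wk → undominated (lose wP (+ᵥ𝐞-≤ᵥ n≤w nk<wk))
    ... | S , Sk , maxS = ℕₚ.<-irrefl refl (ℕₚ.<-≤-trans (weight-+ᵥ𝐞 n Sk) (bounded S _ maxS))

    rankBounded⇒dominated : a ∈ P → RankBounded P n → ∃[ b ] (b ∈ P × n ≤ᵥ b)
    rankBounded⇒dominated {a₀} a₀P = go (<-wellFounded _)
      where
      go : ∀ {m} → Acc _<_ ∣ m ∣ᵥ → RankBounded P m → ∃[ b ] (b ∈ P × m ≤ᵥ b)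
      go {m} (acc rec) bounded with Any.any? (m ≤ᵥ?_) P
      ... | yes dominated = find dominated
      ... | no undominated with any? (λ k → 0 <? lookup m k)
      ...   | no zero-vector = ⊥-elim (undominated (lose a₀P (≤ᵥ-fromLookup λ t →
                                 ℕₚ.≤-trans (ℕₚ.≮⇒≥ (zero-vector ∘ (t ,_))) z≤n)))
      ...   | yes (k , pos) with remove-unit m k pos
      ...     | m′ , refl with go (rec (∣∣ᵥ-mono-< (≤ᵥ-+ᵥ𝐞 m′ k) m′≢m)) (rankBounded-mono (≤ᵥ-+ᵥ𝐞 m′ k) bounded)
        where
        m′≢m : m′ ≢ m′ +ᵥ 𝐞 k
        m′≢m eq = ℕₚ.<-irrefl (cong (λ x → lookup x k) eq) (subst (lookup m′ k <_) (sym (lookup-+ᵥ𝐞-diag m′ k)) (ℕₚ.n<1+n _))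
      ...       | a , aP , m′≤a = ⊥-elim (¬rankBounded-+ᵥ𝐞 aP m′≤a undominated bounded)

module ConvexCombinations where

  open import Algebra.Bundles using (Ring)
  open import Data.Bool using (Bool; true; false; if_then_else_)
  open import Data.Fin using (Fin; zero; suc)
  import Data.Integer as ℤ
  import Data.Integer.Properties as ℤₚ
  open import Data.List using (List; []; _∷_; length; zipWith; map)
  import Data.List.Properties as Listₚ
  open import Data.List.Membership.Propositional using (_∈_)
  open import Data.List.Relation.Unary.All using (All; []; _∷_)
  open import Data.List.Relation.Unary.Any using (here; there)
  open import Data.Nat as ℕ using (ℕ; zero; suc; z≤n)
  import Data.Nat.Properties as ℕₚ
  import Data.Nat.Coprimality as Coprimality
  open import Data.Product using (∃-syntax; _,_)
  open import Data.Empty using (⊥-elim)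
  open import Data.Rational as ℚ using (ℚ; mkℚ; 0ℚ; 1ℚ; _/_; _+_; _*_; _≤_)
  import Data.Rational.Properties as ℚₚ
  open import Data.Vec using (lookup)
  open import Function using (_∘_)
  open import Relation.Binary.PropositionalEquality
  import Algebra.Properties.Semiring.Sum (Ring.semiring ℚₚ.+-*-ring) as ℚΣ
  open Coordinates
  open NatSums
  open Polymatroids using (RankBounded)

  private variable
    p : ℕ
    m n : ℕ

  ℕ→ℚ-mkℚ : ∀ k → ℕ→ℚ k ≡ mkℚ (ℤ.+ k) 0 (Coprimality.sym (Coprimality.1-coprimeTo k))
  ℕ→ℚ-mkℚ k = ℚₚ.normalize-coprime _

  ℕ→ℚ-+ : ∀ m n → ℕ→ℚ (m ℕ.+ n) ≡ ℕ→ℚ m + ℕ→ℚ n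
  ℕ→ℚ-+ m n = trans (cong (_/ 1) (sym (cong₂ ℤ._+_ (ℤₚ.*-identityʳ (ℤ.+ m)) (ℤₚ.*-identityʳ (ℤ.+ n)))))
                    (sym (cong₂ _+_ (ℕ→ℚ-mkℚ m) (ℕ→ℚ-mkℚ n)))

  ℕ→ℚ-mono-≤ : m ℕ.≤ n → ℕ→ℚ m ≤ ℕ→ℚ n
  ℕ→ℚ-mono-≤ {m} {n} m≤n rewrite ℕ→ℚ-mkℚ m | ℕ→ℚ-mkℚ n =
    ℚ.*≤* (subst₂ ℤ._≤_ (sym (ℤₚ.*-identityʳ (ℤ.+ m))) (sym (ℤₚ.*-identityʳ (ℤ.+ n))) (ℤ.+≤+ m≤n))

  ℕ→ℚ-cancel-≤ : ℕ→ℚ m ≤ ℕ→ℚ n → m ℕ.≤ n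
  ℕ→ℚ-cancel-≤ {m} {n} m≤n rewrite ℕ→ℚ-mkℚ m | ℕ→ℚ-mkℚ n with m≤n
  ... | ℚ.*≤* m*1≤n*1 = ℤₚ.drop‿+≤+ (subst₂ ℤ._≤_ (ℤₚ.*-identityʳ (ℤ.+ m)) (ℤₚ.*-identityʳ (ℤ.+ n)) m*1≤n*1)

  ℚΣ-mono-≤ : ∀ {f g : Fin p → ℚ} → (∀ t → f t ≤ g t) → ℚΣ.sum f ≤ ℚΣ.sum g
  ℚΣ-mono-≤ {zero}  f≤g = ℚₚ.≤-refl
  ℚΣ-mono-≤ {suc p} f≤g = ℚₚ.+-mono-≤ (f≤g zero) (ℚΣ-mono-≤ (f≤g ∘ suc))

  ℚΣ-ℕ→ℚ : ∀ (f : Fin p → ℕ) → ℚΣ.sum (ℕ→ℚ ∘ f) ≡ ℕ→ℚ (sum f)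
  ℚΣ-ℕ→ℚ {zero}  f = refl
  ℚΣ-ℕ→ℚ {suc p} f = trans (cong (ℕ→ℚ (f zero) +_) (ℚΣ-ℕ→ℚ (f ∘ suc))) (sym (ℕ→ℚ-+ (f zero) _))

  maskℚ : (Fin p → Bool) → (Fin p → ℚ) → Fin p → ℚ
  maskℚ S f t = if S t then f t else 0ℚ

  weightℚ : (Fin p → Bool) → (Fin p → ℚ) → ℚ
  weightℚ S f = ℚΣ.sum (maskℚ S f)

  weightℚ-zero : ∀ (S : Fin p → Bool) → weightℚ S (λ _ → 0ℚ) ≡ 0ℚ
  weightℚ-zero {p} S = trans (ℚΣ.sum-cong-≗ zero-mask) (ℚΣ.sum-replicate-zero p)
    where
    zero-mask : ∀ t → maskℚ S (λ _ → 0ℚ) t ≡ 0ℚ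
    zero-mask t with S t
    ... | true  = refl
    ... | false = refl

  weightℚ-linear : ∀ S w (f g : Fin p → ℚ) → weightℚ S (λ t → w * f t + g t) ≡ w * weightℚ S f + weightℚ S g
  weightℚ-linear S w f g = begin
    weightℚ S (λ t → w * f t + g t)                       ≡⟨ ℚΣ.sum-cong-≗ split ⟩
    ℚΣ.sum (λ t → w * maskℚ S f t + maskℚ S g t)          ≡⟨ ℚΣ.∑-distrib-+ (λ t → w * maskℚ S f t) (maskℚ S g) ⟩
    ℚΣ.sum (λ t → w * maskℚ S f t) + weightℚ S g          ≡⟨ cong (_+ weightℚ S g) (ℚΣ.*-distribˡ-sum w (maskℚ S f)) ⟨
    w * weightℚ S f + weightℚ S g                         ∎
    where
    open ≡-Reasoning
    split : ∀ t → maskℚ S (λ t → w * f t + g t) t ≡ w * maskℚ S f t + maskℚ S g t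
    split t with S t
    ... | true  = refl
    ... | false = sym (trans (cong (_+ 0ℚ) (ℚₚ.*-zeroʳ w)) (ℚₚ.+-identityˡ 0ℚ))

  weightℚ-ℕ→ℚ : ∀ S (n : Vecℕ p) → weightℚ S (ℕ→ℚ ∘ lookup n) ≡ ℕ→ℚ (weight S n)
  weightℚ-ℕ→ℚ S n = trans (ℚΣ.sum-cong-≗ commute) (ℚΣ-ℕ→ℚ (mask S n))
    where
    commute : ∀ t → maskℚ S (ℕ→ℚ ∘ lookup n) t ≡ ℕ→ℚ (mask S n t)
    commute t with S t
    ... | true  = refl
    ... | false = refl

  weightℚ-combination : ∀ S ws (P : List (Vecℕ p)) →
    weightℚ S (combCoord ws P) ≡ sumℚ (zipWith (λ w b → w * ℕ→ℚ (weight S b)) ws P)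
  weightℚ-combination S []       P       = weightℚ-zero S
  weightℚ-combination S (w ∷ ws) []      = weightℚ-zero S
  weightℚ-combination S (w ∷ ws) (b ∷ P) = begin
    weightℚ S (λ k → w * ℕ→ℚ (lookup b k) + combCoord ws P k)
      ≡⟨ weightℚ-linear S w (ℕ→ℚ ∘ lookup b) (combCoord ws P) ⟩
    w * weightℚ S (ℕ→ℚ ∘ lookup b) + weightℚ S (combCoord ws P)
      ≡⟨ cong₂ (λ x y → w * x + y) (weightℚ-ℕ→ℚ S b) (weightℚ-combination S ws P) ⟩
    w * ℕ→ℚ (weight S b) + sumℚ (zipWith (λ w b → w * ℕ→ℚ (weight S b)) ws P) ∎
    where open ≡-Reasoning

  combination-≤ : ∀ (g : Vecℕ p → ℕ) c ws (P : List (Vecℕ p)) → length ws ≡ length P → All (0ℚ ≤_) ws →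
    (∀ {b} → b ∈ P → g b ℕ.≤ c) → sumℚ (zipWith (λ w b → w * ℕ→ℚ (g b)) ws P) ≤ sumℚ ws * ℕ→ℚ c
  combination-≤ g c []       []      _   _          _     = ℚₚ.≤-reflexive (sym (ℚₚ.*-zeroˡ (ℕ→ℚ c)))
  combination-≤ g c (w ∷ ws) (b ∷ P) len (0≤w ∷ 0≤ws) g≤c =
    ℚₚ.≤-trans (ℚₚ.+-mono-≤ (ℚₚ.*-monoˡ-≤-nonNeg w {{ℚ.nonNegative 0≤w}} (ℕ→ℚ-mono-≤ (g≤c (here refl))))
                            (combination-≤ g c ws P (ℕₚ.suc-injective len) 0≤ws (g≤c ∘ there)))
               (ℚₚ.≤-reflexive (sym (ℚₚ.*-distribʳ-+ (ℕ→ℚ c) w (sumℚ ws))))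

  combination-≥ : ∀ (g : Vecℕ p → ℕ) c ws (P : List (Vecℕ p)) → length ws ≡ length P → All (0ℚ ≤_) ws →
    (∀ {b} → b ∈ P → c ℕ.≤ g b) → sumℚ ws * ℕ→ℚ c ≤ sumℚ (zipWith (λ w b → w * ℕ→ℚ (g b)) ws P)
  combination-≥ g c []       []      _   _          _     = ℚₚ.≤-reflexive (ℚₚ.*-zeroˡ (ℕ→ℚ c))
  combination-≥ g c (w ∷ ws) (b ∷ P) len (0≤w ∷ 0≤ws) c≤g =
    ℚₚ.≤-trans (ℚₚ.≤-reflexive (ℚₚ.*-distribʳ-+ (ℕ→ℚ c) w (sumℚ ws)))
               (ℚₚ.+-mono-≤ (ℚₚ.*-monoˡ-≤-nonNeg w {{ℚ.nonNegative 0≤w}} (ℕ→ℚ-mono-≤ (c≤g (here refl))))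
                            (combination-≥ g c ws P (ℕₚ.suc-injective len) 0≤ws (c≤g ∘ there)))

  module _ (P : List (Vecℕ p)) (n : Vecℕ p) where

    InI⇒rankBounded : InI P n → RankBounded P n
    InI⇒rankBounded (ws , (len , 0≤ws , ∑ws≡1) , n≤comb) S c weight≤c = ℕ→ℚ-cancel-≤ (begin
      ℕ→ℚ (weight S n)                                        ≡⟨ weightℚ-ℕ→ℚ S n ⟨
      weightℚ S (ℕ→ℚ ∘ lookup n)                              ≤⟨ ℚΣ-mono-≤ masked-≤ ⟩
      weightℚ S (combCoord ws P)                              ≡⟨ weightℚ-combination S ws P ⟩
      sumℚ (zipWith (λ w b → w * ℕ→ℚ (weight S b)) ws P)      ≤⟨ combination-≤ (weight S) c ws P len 0≤ws weight≤c ⟩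
      sumℚ ws * ℕ→ℚ c                                         ≡⟨ cong (_* ℕ→ℚ c) ∑ws≡1 ⟩
      1ℚ * ℕ→ℚ c                                              ≡⟨ ℚₚ.*-identityˡ _ ⟩
      ℕ→ℚ c                                                   ∎)
      where
      open ℚₚ.≤-Reasoning
      masked-≤ : ∀ t → maskℚ S (ℕ→ℚ ∘ lookup n) t ≤ maskℚ S (combCoord ws P) t
      masked-≤ t with S t
      ... | true  = n≤comb t
      ... | false = ℚₚ.≤-refl

    InB⇒weight≥ : InB P n → ∀ S c → (∀ {b} → b ∈ P → c ℕ.≤ weight S b) → c ℕ.≤ weight S n
    InB⇒weight≥ (ws , (len , 0≤ws , ∑ws≡1) , n≡comb) S c c≤weight = ℕ→ℚ-cancel-≤ (begin
      ℕ→ℚ c                                                   ≡⟨ ℚₚ.*-identityˡ _ ⟨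
      1ℚ * ℕ→ℚ c                                              ≡⟨ cong (_* ℕ→ℚ c) ∑ws≡1 ⟨
      sumℚ ws * ℕ→ℚ c                                         ≤⟨ combination-≥ (weight S) c ws P len 0≤ws c≤weight ⟩
      sumℚ (zipWith (λ w b → w * ℕ→ℚ (weight S b)) ws P)      ≡⟨ weightℚ-combination S ws P ⟨
      weightℚ S (combCoord ws P)                              ≡⟨ ℚΣ.sum-cong-≗ masked-≡ ⟩
      weightℚ S (ℕ→ℚ ∘ lookup n)                              ≡⟨ weightℚ-ℕ→ℚ S n ⟩
      ℕ→ℚ (weight S n)                                        ∎)
      where
      open ℚₚ.≤-Reasoning
      masked-≡ : ∀ t → maskℚ S (combCoord ws P) t ≡ maskℚ S (ℕ→ℚ ∘ lookup n) t
      masked-≡ t with S t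
      ... | true  = n≡comb t
      ... | false = refl

    InB⇒InI : InB P n → InI P n
    InB⇒InI (ws , convex , n≡comb) = ws , convex , λ k → ℚₚ.≤-reflexive (sym (n≡comb k))

  InI⇒nonempty : ∀ (P : List (Vecℕ p)) n → InI P n → ∃[ a ] a ∈ P
  InI⇒nonempty (a ∷ _) _ _                          = a , here refl
  InI⇒nonempty []      _ ([] , (_ , _ , ∑ws≡1) , _) = ⊥-elim (ℚₚ.1≢0 (sym ∑ws≡1))

  zeros : List (Vecℕ p) → List ℚ
  zeros = map (λ _ → 0ℚ)

  zeros-nonNeg : ∀ (xs : List (Vecℕ p)) → All (0ℚ ≤_) (zeros xs)
  zeros-nonNeg []       = []
  zeros-nonNeg (x ∷ xs) = ℚₚ.≤-refl ∷ zeros-nonNeg xs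

  zeros-sum : ∀ (xs : List (Vecℕ p)) → sumℚ (zeros xs) ≡ 0ℚ
  zeros-sum []       = refl
  zeros-sum (x ∷ xs) = trans (ℚₚ.+-identityˡ _) (zeros-sum xs)

  zeros-combCoord : ∀ (xs : List (Vecℕ p)) k → combCoord (zeros xs) xs k ≡ 0ℚ
  zeros-combCoord []       k = refl
  zeros-combCoord (x ∷ xs) k = trans (cong₂ _+_ (ℚₚ.*-zeroˡ (ℕ→ℚ (lookup x k))) (zeros-combCoord xs k)) (ℚₚ.+-identityˡ 0ℚ)

  indicator : ∀ {a} (xs : List (Vecℕ p)) → a ∈ xs → List ℚ
  indicator (x ∷ xs) (here _)  = 1ℚ ∷ zeros xs
  indicator (x ∷ xs) (there a∈xs) = 0ℚ ∷ indicator xs a∈xs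

  indicator-convWeights : ∀ {a} (xs : List (Vecℕ p)) (a∈xs : a ∈ xs) → IsConvWeights xs (indicator xs a∈xs)
  indicator-convWeights (x ∷ xs) (here _) =
    cong suc (Listₚ.length-map _ xs) , ℚ.*≤* (ℤ.+≤+ z≤n) ∷ zeros-nonNeg xs ,
    trans (cong (1ℚ +_) (zeros-sum xs)) (ℚₚ.+-identityʳ 1ℚ)
  indicator-convWeights (x ∷ xs) (there a∈xs) with indicator-convWeights xs a∈xs
  ... | len , 0≤ws , ∑ws≡1 = cong suc len , ℚₚ.≤-refl ∷ 0≤ws , trans (ℚₚ.+-identityˡ _) ∑ws≡1

  indicator-combCoord : ∀ {a} (xs : List (Vecℕ p)) (a∈xs : a ∈ xs) k →
    combCoord (indicator xs a∈xs) xs k ≡ ℕ→ℚ (lookup a k)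
  indicator-combCoord (x ∷ xs) (here refl) k =
    trans (cong₂ _+_ (ℚₚ.*-identityˡ (ℕ→ℚ (lookup x k))) (zeros-combCoord xs k)) (ℚₚ.+-identityʳ _)
  indicator-combCoord (x ∷ xs) (there a∈xs) k =
    trans (cong₂ _+_ (ℚₚ.*-zeroˡ (ℕ→ℚ (lookup x k))) (indicator-combCoord xs a∈xs k)) (ℚₚ.+-identityˡ _)

  dominated⇒InI : ∀ {P : List (Vecℕ p)} {a n} → a ∈ P → n ≤ᵥ a → InI P n
  dominated⇒InI {P = P} {n = n} a∈P n≤a = indicator P a∈P , indicator-convWeights P a∈P ,
    λ k → subst (ℕ→ℚ (lookup n k) ≤_) (sym (indicator-combCoord P a∈P k)) (ℕ→ℚ-mono-≤ (≤ᵥ-lookup n≤a k))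

module IntegerSums where

  open import Data.Bool using (Bool; true; false; if_then_else_; _∧_)
  open import Data.Empty using (⊥-elim)
  open import Data.Fin using (Fin; zero; suc)
  open import Data.Fin.Properties using (¬∀⟶∃¬)
  open import Data.Product using (_,_)
  open import Data.Integer using (ℤ; +_; -_; _+_; _-_; _*_)
  import Data.Integer.Properties as ℤₚ
  open import Data.Integer.Tactic.RingSolver using (solve-∀)
  open import Data.List using (List; []; _∷_; _++_; map; concatMap; filter; upTo)
  import Data.List.Properties as Listₚ
  open import Data.Nat as ℕ using (ℕ; zero; suc; s≤s)
  import Data.Nat.Properties as ℕₚ
  open import Data.Vec using ([]; _∷_; lookup; head; tail)
  open import Function using (_∘_)
  open import Relation.Nullary using (¬_; Dec; yes; no; does; ¬?; _×-dec_)
  open import Relation.Nullary.Decidable using (dec-true; dec-false)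
  open import Level using (0ℓ)
  open import Relation.Unary using (Pred; Decidable)
  open import Relation.Binary.PropositionalEquality
  import Algebra.Properties.CommutativeMonoid.Sum ℤₚ.*-1-commutativeMonoid as ℤΠ

  private variable
    A B : Set
    p : ℕ

  ⟦_⟧ : Bool → ℤ
  ⟦ b ⟧ = if b then + 1 else + 0

  ⟦⟧-yes : ∀ {A : Set} (d : Dec A) → A → ⟦ does d ⟧ ≡ + 1
  ⟦⟧-yes d a = cong ⟦_⟧ (dec-true d a)

  ⟦⟧-no : ∀ {A : Set} (d : Dec A) → ¬ A → ⟦ does d ⟧ ≡ + 0
  ⟦⟧-no d ¬a = cong ⟦_⟧ (dec-false d ¬a)

  ⟦⟧-∧ : ∀ b₁ b₂ → ⟦ b₁ ∧ b₂ ⟧ ≡ ⟦ b₁ ⟧ * ⟦ b₂ ⟧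
  ⟦⟧-∧ true  true  = refl
  ⟦⟧-∧ true  false = refl
  ⟦⟧-∧ false b₂    = refl

  ⟦⟧-×-¬ : ∀ {X Z : Set} (x : Dec X) (z : Dec Z) → (Z → X) → ⟦ does (x ×-dec ¬? z) ⟧ ≡ ⟦ does x ⟧ - ⟦ does z ⟧
  ⟦⟧-×-¬ (yes _) (yes _) _   = refl
  ⟦⟧-×-¬ (yes _) (no _)  _   = refl
  ⟦⟧-×-¬ (no ¬x) (yes z) Z⇒X = ⊥-elim (¬x (Z⇒X z))
  ⟦⟧-×-¬ (no _)  (no _)  _   = refl

  ⟦⟧-×-¬× : ∀ {X Y Z : Set} (x : Dec X) (y : Dec Y) (z : Dec Z) → (Z → X) →
    ⟦ does (x ×-dec ¬? (y ×-dec z)) ⟧ ≡ ⟦ does x ⟧ - ⟦ does y ⟧ * ⟦ does z ⟧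
  ⟦⟧-×-¬× (yes _) (yes _) (yes _) _   = refl
  ⟦⟧-×-¬× (yes _) (yes _) (no _)  _   = refl
  ⟦⟧-×-¬× (yes _) (no _)  (yes _) _   = refl
  ⟦⟧-×-¬× (yes _) (no _)  (no _)  _   = refl
  ⟦⟧-×-¬× (no ¬x) _       (yes z) Z⇒X = ⊥-elim (¬x (Z⇒X z))
  ⟦⟧-×-¬× (no _)  (yes _) (no _)  _   = refl
  ⟦⟧-×-¬× (no _)  (no _)  (no _)  _   = refl

  ∑ : List A → (A → ℤ) → ℤ
  ∑ xs f = sumℤ (map f xs)

  syntax ∑ xs (λ x → e) = ∑[ x ∈ xs ] e

  ∑-cong : ∀ (xs : List A) {f g : A → ℤ} → (∀ x → f x ≡ g x) → ∑ xs f ≡ ∑ xs g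
  ∑-cong []       f≗g = refl
  ∑-cong (x ∷ xs) f≗g = cong₂ _+_ (f≗g x) (∑-cong xs f≗g)

  ∑-zero : ∀ (xs : List A) {f : A → ℤ} → (∀ x → f x ≡ + 0) → ∑ xs f ≡ + 0
  ∑-zero []       f≗0 = refl
  ∑-zero (x ∷ xs) f≗0 = cong₂ _+_ (f≗0 x) (∑-zero xs f≗0)

  ∑-distrib-+ : ∀ (xs : List A) (f g : A → ℤ) → ∑[ x ∈ xs ] (f x + g x) ≡ ∑ xs f + ∑ xs g
  ∑-distrib-+ []       f g = refl
  ∑-distrib-+ (x ∷ xs) f g = trans (cong (λ s → f x + g x + s) (∑-distrib-+ xs f g)) (swap (f x) (g x) _ _)
    where
    swap : ∀ a b c d → a + b + (c + d) ≡ a + c + (b + d)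
    swap = solve-∀

  *-distribˡ-∑ : ∀ c (xs : List A) (f : A → ℤ) → c * ∑ xs f ≡ ∑[ x ∈ xs ] (c * f x)
  *-distribˡ-∑ c []       f = ℤₚ.*-zeroʳ c
  *-distribˡ-∑ c (x ∷ xs) f = trans (ℤₚ.*-distribˡ-+ c (f x) _) (cong (λ s → c * f x + s) (*-distribˡ-∑ c xs f))

  *-distribʳ-∑ : ∀ c (xs : List A) (f : A → ℤ) → ∑ xs f * c ≡ ∑[ x ∈ xs ] (f x * c)
  *-distribʳ-∑ c xs f = trans (ℤₚ.*-comm _ c) (trans (*-distribˡ-∑ c xs f) (∑-cong xs (λ x → ℤₚ.*-comm c (f x))))

  ∑-map : ∀ (g : A → B) (xs : List A) (f : B → ℤ) → ∑ (map g xs) f ≡ ∑[ x ∈ xs ] f (g x)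
  ∑-map g xs f = cong sumℤ (sym (Listₚ.map-∘ xs))

  ∑-++ : ∀ (xs ys : List A) (f : A → ℤ) → ∑ (xs ++ ys) f ≡ ∑ xs f + ∑ ys f
  ∑-++ []       ys f = sym (ℤₚ.+-identityˡ _)
  ∑-++ (x ∷ xs) ys f = trans (cong (λ s → f x + s) (∑-++ xs ys f)) (sym (ℤₚ.+-assoc (f x) _ _))

  ∑-concatMap : ∀ (g : A → List B) (xs : List A) (f : B → ℤ) → ∑ (concatMap g xs) f ≡ ∑[ x ∈ xs ] ∑ (g x) f
  ∑-concatMap g []       f = refl
  ∑-concatMap g (x ∷ xs) f = trans (∑-++ (g x) (concatMap g xs) f) (cong (λ s → ∑ (g x) f + s) (∑-concatMap g xs f))

  ∑-comm : ∀ (xs : List A) (ys : List B) (f : A → B → ℤ) → ∑[ x ∈ xs ] ∑[ y ∈ ys ] f x y ≡ ∑[ y ∈ ys ] ∑[ x ∈ xs ] f x y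
  ∑-comm []       ys f = sym (∑-zero ys (λ _ → refl))
  ∑-comm (x ∷ xs) ys f = trans (cong (λ s → ∑ ys (f x) + s) (∑-comm xs ys f)) (sym (∑-distrib-+ ys (f x) _))

  ∑-filter : ∀ {Q : Pred A 0ℓ} (Q? : Decidable Q) (xs : List A) (f : A → ℤ) → ∑ (filter Q? xs) f ≡ ∑[ x ∈ xs ] (⟦ does (Q? x) ⟧ * f x)
  ∑-filter Q? []       f = refl
  ∑-filter Q? (x ∷ xs) f with does (Q? x)
  ... | true  = cong₂ _+_ (sym (ℤₚ.*-identityˡ (f x))) (∑-filter Q? xs f)
  ... | false = trans (∑-filter Q? xs f) (sym (ℤₚ.+-identityˡ _))

  ∑-upTo-suc : ∀ K (f : ℕ → ℤ) → ∑ (upTo (suc K)) f ≡ f 0 + ∑[ t ∈ upTo K ] f (suc t)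
  ∑-upTo-suc K f = cong (λ s → f 0 + s) (trans (cong (λ ts → ∑ ts f) (sym (Listₚ.map-upTo suc K))) (∑-map suc (upTo K) f))

  ⟦⟧-⇔ : ∀ {A B : Set} (a? : Dec A) (b? : Dec B) → (A → B) → (B → A) → ⟦ does a? ⟧ ≡ ⟦ does b? ⟧
  ⟦⟧-⇔ (yes a) b? A⇒B B⇒A = sym (⟦⟧-yes b? (A⇒B a))
  ⟦⟧-⇔ (no ¬a) b? A⇒B B⇒A = sym (⟦⟧-no b? (¬a ∘ B⇒A))

  ∏ : (Fin p → ℤ) → ℤ
  ∏ = ℤΠ.sum

  ∏-syntax : ∀ p → (Fin p → ℤ) → ℤ
  ∏-syntax _ = ∏

  syntax ∏-syntax p (λ ℓ → e) = ∏[ ℓ < p ] e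

  ∏-cong : ∀ {f g : Fin p → ℤ} → (∀ ℓ → f ℓ ≡ g ℓ) → ∏ f ≡ ∏ g
  ∏-cong = ℤΠ.sum-cong-≗

  ∏-distrib-* : ∀ (f g : Fin p → ℤ) → ∏ (λ ℓ → f ℓ * g ℓ) ≡ ∏ f * ∏ g
  ∏-distrib-* = ℤΠ.∑-distrib-+

  ∏-zero : ∀ (f : Fin p → ℤ) ℓ → f ℓ ≡ + 0 → ∏ f ≡ + 0
  ∏-zero f zero    f0≡0 = cong (_* ∏ (f ∘ suc)) f0≡0
  ∏-zero f (suc ℓ) fℓ≡0 = trans (cong (f zero *_) (∏-zero (f ∘ suc) ℓ fℓ≡0)) (ℤₚ.*-zeroʳ (f zero))

  ∏-⟦⟧ : ∀ {Q : Fin p → Set} (Q? : ∀ ℓ → Dec (Q ℓ)) {R : Set} (R? : Dec R) →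
    (R → ∀ ℓ → Q ℓ) → ((∀ ℓ → Q ℓ) → R) → ∏ (λ ℓ → ⟦ does (Q? ℓ) ⟧) ≡ ⟦ does R? ⟧
  ∏-⟦⟧ {p} {Q} Q? (yes r) R⇒Q Q⇒R = trans (∏-cong (λ ℓ → ⟦⟧-yes (Q? ℓ) (R⇒Q r ℓ))) (ℤΠ.sum-replicate-zero p)
  ∏-⟦⟧ {p} {Q} Q? (no ¬r) R⇒Q Q⇒R with ¬∀⟶∃¬ p Q Q? (¬r ∘ Q⇒R)
  ... | ℓ , ¬Qℓ = ∏-zero _ ℓ (⟦⟧-no (Q? ℓ) ¬Qℓ)

  ∑-box-∏ : ∀ p K (g : Fin p → ℕ → ℤ) →
    ∑[ m ∈ box p K ] ∏ (λ ℓ → g ℓ (lookup m ℓ)) ≡ ∏ (λ ℓ → ∑ (upTo (suc K)) (g ℓ))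
  ∑-box-∏ zero    K g = refl
  ∑-box-∏ (suc p) K g = begin
    ∑ (concatMap (λ x → map (x ∷_) (box p K)) (upTo (suc K))) G
      ≡⟨ ∑-concatMap (λ x → map (x ∷_) (box p K)) (upTo (suc K)) G ⟩
    ∑[ x ∈ upTo (suc K) ] ∑ (map (x ∷_) (box p K)) G
      ≡⟨ ∑-cong (upTo (suc K)) (λ x → ∑-map (x ∷_) (box p K) G) ⟩
    ∑[ x ∈ upTo (suc K) ] ∑[ m ∈ box p K ] (g zero x * G′ m)
      ≡⟨ ∑-cong (upTo (suc K)) (λ x → *-distribˡ-∑ (g zero x) (box p K) G′) ⟨
    ∑[ x ∈ upTo (suc K) ] (g zero x * ∑ (box p K) G′)
      ≡⟨ *-distribʳ-∑ _ (upTo (suc K)) (g zero) ⟨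
    ∑ (upTo (suc K)) (g zero) * ∑ (box p K) G′
      ≡⟨ cong (∑ (upTo (suc K)) (g zero) *_) (∑-box-∏ p K (g ∘ suc)) ⟩
    ∏ (λ ℓ → ∑ (upTo (suc K)) (g ℓ)) ∎
    where
    open ≡-Reasoning
    G : Vecℕ (suc p) → ℤ
    G m = ∏ (λ ℓ → g ℓ (lookup m ℓ))
    G′ : Vecℕ p → ℤ
    G′ m = ∏ (λ ℓ → g (suc ℓ) (lookup m ℓ))

  ∑-upTo-δ : ∀ K (f : ℕ → ℤ) {c} → c ℕ.≤ K → ∑[ t ∈ upTo (suc K) ] (⟦ does (t ℕ.≟ c) ⟧ * f t) ≡ f c
  ∑-upTo-δ K f {c} c≤K = trans (∑-upTo-suc K (λ t → ⟦ does (t ℕ.≟ c) ⟧ * f t)) (split c≤K)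
    where
    split : ∀ {K c} → c ℕ.≤ K →
      ⟦ does (0 ℕ.≟ c) ⟧ * f 0 + ∑[ t ∈ upTo K ] (⟦ does (suc t ℕ.≟ c) ⟧ * f (suc t)) ≡ f c
    split {K} {zero} _ = trans (cong₂ _+_ (ℤₚ.*-identityˡ (f 0)) (∑-zero (upTo K) (λ _ → refl))) (ℤₚ.+-identityʳ _)
    split {suc K} {suc c} (s≤s c≤K) = trans (ℤₚ.+-identityˡ _) (∑-upTo-δ K (f ∘ suc) c≤K)

  ∑-upTo-δ-suc : ∀ K N {c} → c ℕ.≤ K →
    ∑[ t ∈ upTo (suc K) ] (⟦ does (suc t ℕ.≟ c) ⟧ * ⟦ does (N ℕ.≤? t) ⟧) ≡ ⟦ does (N ℕ.<? c) ⟧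
  ∑-upTo-δ-suc K N {zero}  _   = trans (∑-zero (upTo (suc K)) (λ _ → refl)) (sym (⟦⟧-no (N ℕ.<? 0) λ ()))
  ∑-upTo-δ-suc K N {suc c} c<K = trans (∑-upTo-δ K (λ t → ⟦ does (N ℕ.≤? t) ⟧) (ℕₚ.<⇒≤ c<K))
                                       (⟦⟧-⇔ (N ℕ.≤? c) (N ℕ.<? suc c) s≤s ℕₚ.≤-pred)

  ⟦⟧-∷ : ∀ x y (u v : Vecℕ p) → ⟦ does ((x ∷ u) ≟ᵥ (y ∷ v)) ⟧ ≡ ⟦ does (x ℕ.≟ y) ⟧ * ⟦ does (u ≟ᵥ v) ⟧
  ⟦⟧-∷ x y u v = trans (⟦⟧-⇔ ((x ∷ u) ≟ᵥ (y ∷ v)) ((x ℕ.≟ y) ×-dec (u ≟ᵥ v))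
                               (λ eq → cong head eq , cong tail eq) (λ (x≡y , u≡v) → cong₂ _∷_ x≡y u≡v))
                        (⟦⟧-∧ (does (x ℕ.≟ y)) (does (u ≟ᵥ v)))

  ∑-box-δ : ∀ p K (F : Vecℕ p → ℤ) (n : Vecℕ p) → (∀ ℓ → lookup n ℓ ℕ.≤ K) →
    ∑[ m ∈ box p K ] (⟦ does (m ≟ᵥ n) ⟧ * F m) ≡ F n
  ∑-box-δ zero    K F [] _ = trans (ℤₚ.+-identityʳ _) (ℤₚ.*-identityˡ (F []))
  ∑-box-δ (suc p) K F (y ∷ n) n≤K = begin
    ∑ (concatMap (λ x → map (x ∷_) (box p K)) (upTo (suc K))) H
      ≡⟨ ∑-concatMap (λ x → map (x ∷_) (box p K)) (upTo (suc K)) H ⟩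
    ∑[ x ∈ upTo (suc K) ] ∑ (map (x ∷_) (box p K)) H
      ≡⟨ ∑-cong (upTo (suc K)) (λ x → trans (∑-map (x ∷_) (box p K) H) (∑-cong (box p K) (factor x))) ⟩
    ∑[ x ∈ upTo (suc K) ] ∑[ m ∈ box p K ] (⟦ does (x ℕ.≟ y) ⟧ * (⟦ does (m ≟ᵥ n) ⟧ * F (x ∷ m)))
      ≡⟨ ∑-cong (upTo (suc K)) (λ x → *-distribˡ-∑ ⟦ does (x ℕ.≟ y) ⟧ (box p K) (λ m → ⟦ does (m ≟ᵥ n) ⟧ * F (x ∷ m))) ⟨
    ∑[ x ∈ upTo (suc K) ] (⟦ does (x ℕ.≟ y) ⟧ * ∑[ m ∈ box p K ] (⟦ does (m ≟ᵥ n) ⟧ * F (x ∷ m)))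
      ≡⟨ ∑-cong (upTo (suc K)) (λ x → cong (⟦ does (x ℕ.≟ y) ⟧ *_) (∑-box-δ p K (F ∘ (x ∷_)) n (n≤K ∘ suc))) ⟩
    ∑[ x ∈ upTo (suc K) ] (⟦ does (x ℕ.≟ y) ⟧ * F (x ∷ n))
      ≡⟨ ∑-upTo-δ K (λ x → F (x ∷ n)) (n≤K zero) ⟩
    F (y ∷ n) ∎
    where
    open ≡-Reasoning
    H : Vecℕ (suc p) → ℤ
    H m = ⟦ does (m ≟ᵥ (y ∷ n)) ⟧ * F m
    factor : ∀ x m → H (x ∷ m) ≡ ⟦ does (x ℕ.≟ y) ⟧ * (⟦ does (m ≟ᵥ n) ⟧ * F (x ∷ m))
    factor x m = trans (cong (_* F (x ∷ m)) (⟦⟧-∷ x y m n)) (ℤₚ.*-assoc ⟦ does (x ℕ.≟ y) ⟧ ⟦ does (m ≟ᵥ n) ⟧ (F (x ∷ m)))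

module Signs where

  open import Data.Fin using (Fin; zero; suc)
  open import Data.Integer as ℤ using (ℤ; +_; -_; _-_; _*_)
  import Data.Integer.Properties as ℤₚ
  open import Data.Integer.Tactic.RingSolver using (solve-∀)
  open import Data.Bool using (if_then_else_)
  open import Data.Nat as ℕ using (ℕ; zero; suc; _+_; _∸_; _≤_; _%_)
  open import Data.Nat.DivMod using ([m+n]%n≡m%n)
  import Data.Nat.Properties as ℕₚ
  open import Function using (_∘_)
  open import Relation.Nullary using (does)
  open import Relation.Binary.PropositionalEquality
  open NatSums
  open IntegerSums

  private variable
    p : ℕ

  negOne^_ : ℕ → ℤ
  negOne^ d = negOnePow (+ d)

  negOne^-suc-suc : ∀ d → negOne^ suc (suc d) ≡ negOne^ d
  negOne^-suc-suc d = cong (λ r → if does (r ℕ.≟ 0) then + 1 else - (+ 1))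
                            (trans (cong (_% 2) (ℕₚ.+-comm 2 d)) ([m+n]%n≡m%n d 2))

  negOne^-suc : ∀ d → negOne^ suc d ≡ - (negOne^ d)
  negOne^-suc zero          = refl
  negOne^-suc (suc zero)    = refl
  negOne^-suc (suc (suc d)) = trans (negOne^-suc-suc (suc d)) (trans (negOne^-suc d) (cong -_ (sym (negOne^-suc-suc d))))

  negOne^-+ : ∀ x y → negOne^ (x + y) ≡ negOne^ x * negOne^ y
  negOne^-+ zero    y = sym (ℤₚ.*-identityˡ (negOne^ y))
  negOne^-+ (suc x) y = begin
    negOne^ suc (x + y)            ≡⟨ negOne^-suc (x + y) ⟩
    - (negOne^ (x + y))            ≡⟨ cong -_ (negOne^-+ x y) ⟩
    - (negOne^ x * negOne^ y)      ≡⟨ ℤₚ.neg-distribˡ-* (negOne^ x) (negOne^ y) ⟩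
    - (negOne^ x) * negOne^ y      ≡⟨ cong (_* negOne^ y) (negOne^-suc x) ⟨
    negOne^ suc x * negOne^ y      ∎
    where open ≡-Reasoning

  negOnePow-∸ : ∀ {x y} → y ≤ x → negOnePow (+ x - + y) ≡ negOne^ (x ∸ y)
  negOnePow-∸ {x} {y} y≤x = cong negOnePow (begin
    + x - + y                 ≡⟨ cong (λ z → + z - + y) (ℕₚ.m+[n∸m]≡n y≤x) ⟨
    + (y + (x ∸ y)) - + y     ≡⟨ cong (_- + y) (ℤₚ.pos-+ y (x ∸ y)) ⟩
    + y ℤ.+ + (x ∸ y) - + y   ≡⟨ cancel (+ y) (+ (x ∸ y)) ⟩
    + (x ∸ y)                 ∎)
    where
    open ≡-Reasoning
    cancel : ∀ a b → a ℤ.+ b - a ≡ b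
    cancel = solve-∀

  ∏-negOne^ : ∀ (f : Fin p → ℕ) → ∏ (λ ℓ → negOne^ f ℓ) ≡ negOne^ (sum f)
  ∏-negOne^ {zero}  f = refl
  ∏-negOne^ {suc p} f = trans (cong (negOne^ f zero *_) (∏-negOne^ (f ∘ suc))) (sym (negOne^-+ (f zero) _))

module Stalactites {p : ℕ} (a : Vecℕ p) (V : List (Vecℕ p)) where

  open import Data.Bool using (Bool; true; false; if_then_else_; not)
  open import Data.Fin using (Fin)
  open import Data.Fin.Properties using (all?; ¬∀⟶∃¬) renaming (_≟_ to _≟ᶠ_)
  open import Data.List.Membership.Propositional using (find) renaming (_∈_ to _∈ₗ_)
  open import Data.Fin.Subset using (Subset; _∈_)
  open import Data.Integer using (ℤ; +_; -_; _+_; _-_; _*_)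
  import Data.Integer.Properties as ℤₚ
  open import Data.Integer.Tactic.RingSolver using (solve-∀)
  open import Data.List using (List; upTo)
  open import Data.Nat as ℕ using (ℕ; suc; _∸_; _≤_; _<_; _≤?_; _<?_)
  import Data.Nat.Properties as ℕₚ
  open import Data.Product using (_×_; _,_; proj₁; proj₂)
  open import Data.Sum using (_⊎_; inj₁; inj₂)
  open import Data.Vec using (lookup; tabulate)
  open import Data.Vec.Properties using (lookup∘tabulate; []=⇒lookup; lookup⇒[]=)
  open import Function using (_∘_)
  open import Relation.Nullary using (¬_; Dec; yes; no; does; ¬?; _×-dec_; _⊎-dec_; _→-dec_)
  open import Relation.Nullary.Decidable using (dec-true; dec-false)
  open import Relation.Binary.PropositionalEquality hiding (J)
  open Coordinates
  open NatSums
  open IntegerSums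
  open Signs

  Admissible : Vecℕ p → Fin p → Set
  Admissible m ℓ = lookup m ℓ ≡ lookup a ℓ ⊎ (InL a V ℓ × suc (lookup m ℓ) ≡ lookup a ℓ)

  admissible? : ∀ m ℓ → Dec (Admissible m ℓ)
  admissible? m ℓ = (lookup m ℓ ℕ.≟ lookup a ℓ) ⊎-dec (inL? a V ℓ ×-dec (suc (lookup m ℓ) ℕ.≟ lookup a ℓ))

  InSt⇒admissible : ∀ {m} → InSt m a V → ∀ ℓ → Admissible m ℓ
  InSt⇒admissible {m} (J , J⊆L , m+𝐞J≡a) ℓ =
    by-membership (lookup J ℓ) refl (trans (sym (lookup-+ᵥ𝐞ₛ m J ℓ)) (cong (λ x → lookup x ℓ) m+𝐞J≡a))
    where
    by-membership : ∀ b → lookup J ℓ ≡ b → lookup m ℓ ℕ.+ (if b then 1 else 0) ≡ lookup a ℓ → Admissible m ℓ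
    by-membership true  Jℓ m+1≡a = inj₂ (J⊆L ℓ (lookup⇒[]= ℓ J Jℓ) , trans (ℕₚ.+-comm 1 _) m+1≡a)
    by-membership false _  m+0≡a = inj₁ (trans (sym (ℕₚ.+-identityʳ _)) m+0≡a)

  admissible⇒InSt : ∀ {m} → (∀ ℓ → Admissible m ℓ) → InSt m a V
  admissible⇒InSt {m} admissible = J , J⊆L , ≡-fromLookup m+𝐞J≐a
    where
    moved : Fin p → Bool
    moved ℓ = not (does (lookup m ℓ ℕ.≟ lookup a ℓ))
    J : Subset p
    J = tabulate moved
    J⊆L : ∀ ℓ → ℓ ∈ J → InL a V ℓ
    J⊆L ℓ ℓ∈J with admissible ℓ
    ... | inj₂ (inL , _) = inL
    ... | inj₁ mℓ≡aℓ with () ← trans (sym ([]=⇒lookup ℓ∈J))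
                                 (trans (lookup∘tabulate moved ℓ) (cong not (dec-true (lookup m ℓ ℕ.≟ lookup a ℓ) mℓ≡aℓ)))
    m+𝐞J≐a : ∀ ℓ → lookup (m +ᵥ 𝐞ₛ J) ℓ ≡ lookup a ℓ
    m+𝐞J≐a ℓ = trans (lookup-+ᵥ𝐞ₛ m J ℓ) (trans (cong (λ b → lookup m ℓ ℕ.+ (if b then 1 else 0)) (lookup∘tabulate moved ℓ)) (step (admissible ℓ)))
      where
      step : Admissible m ℓ → lookup m ℓ ℕ.+ (if moved ℓ then 1 else 0) ≡ lookup a ℓ
      step (inj₁ mℓ≡aℓ) rewrite dec-true (lookup m ℓ ℕ.≟ lookup a ℓ) mℓ≡aℓ = trans (ℕₚ.+-identityʳ _) mℓ≡aℓ
      step (inj₂ (_ , 1+mℓ≡aℓ)) rewrite dec-false (lookup m ℓ ℕ.≟ lookup a ℓ) (λ e → ℕₚ.<-irrefl (trans e (sym 1+mℓ≡aℓ)) (ℕₚ.n<1+n _))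
        = trans (ℕₚ.+-comm _ 1) 1+mℓ≡aℓ

  InSt⇒≤ᵥ : ∀ {m} → InSt m a V → m ≤ᵥ a
  InSt⇒≤ᵥ {m} (J , _ , m+𝐞J≡a) = ≤ᵥ-fromLookup λ ℓ →
    subst (lookup m ℓ ≤_) (trans (sym (lookup-+ᵥ m (𝐞ₛ J) ℓ)) (cong (λ x → lookup x ℓ) m+𝐞J≡a)) (ℕₚ.m≤m+n _ _)

  -- Since St(a;V) is a box, (−1)^(|a|−|m|) · [m ∈ St(a;V)] is the product over ℓ of shape ℓ m_ℓ.
  shape : Fin p → ℕ → ℤ
  shape ℓ t = ⟦ does (t ℕ.≟ lookup a ℓ) ⟧ - ⟦ does (inL? a V ℓ) ⟧ * ⟦ does (suc t ℕ.≟ lookup a ℓ) ⟧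

  shape-admissible : ∀ m ℓ → Admissible m ℓ → shape ℓ (lookup m ℓ) ≡ negOne^ (lookup a ℓ ∸ lookup m ℓ)
  shape-admissible m ℓ = at (lookup m ℓ)
    where
    L : ℤ
    L = ⟦ does (inL? a V ℓ) ⟧
    at : ∀ t → t ≡ lookup a ℓ ⊎ (InL a V ℓ × suc t ≡ lookup a ℓ) → shape ℓ t ≡ negOne^ (lookup a ℓ ∸ t)
    at t (inj₁ refl) = begin
      ⟦ does (t ℕ.≟ t) ⟧ - L * ⟦ does (suc t ℕ.≟ t) ⟧ ≡⟨ cong₂ (λ x y → x - L * y) (⟦⟧-yes (t ℕ.≟ t) refl) (⟦⟧-no (suc t ℕ.≟ t) (ℕₚ.1+n≢n)) ⟩
      + 1 - L * + 0                                   ≡⟨ cong (λ z → + 1 - z) (ℤₚ.*-zeroʳ L) ⟩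
      negOne^ 0                                       ≡⟨ cong negOne^_ (ℕₚ.n∸n≡0 t) ⟨
      negOne^ (t ∸ t)                                 ∎
      where open ≡-Reasoning
    at t (inj₂ (inL , 1+t≡aℓ)) rewrite sym 1+t≡aℓ = begin
      ⟦ does (t ℕ.≟ suc t) ⟧ - L * ⟦ does (t ℕ.≟ t) ⟧ ≡⟨ cong₂ (λ x y → x - y * ⟦ does (t ℕ.≟ t) ⟧) (⟦⟧-no (t ℕ.≟ suc t) (ℕₚ.1+n≢n ∘ sym)) (⟦⟧-yes (inL? a V ℓ) inL) ⟩
      + 0 - + 1 * ⟦ does (t ℕ.≟ t) ⟧                 ≡⟨ cong (λ y → + 0 - + 1 * y) (⟦⟧-yes (t ℕ.≟ t) refl) ⟩
      negOne^ 1                                       ≡⟨ cong negOne^_ (ℕₚ.m+n∸n≡m 1 t) ⟨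
      negOne^ (suc t ∸ t)                             ∎
      where open ≡-Reasoning

  shape-inadmissible : ∀ m ℓ → ¬ Admissible m ℓ → shape ℓ (lookup m ℓ) ≡ + 0
  shape-inadmissible m ℓ ¬admissible =
    cong₂ _-_ (⟦⟧-no (lookup m ℓ ℕ.≟ lookup a ℓ) (¬admissible ∘ inj₁))
              (trans (sym (⟦⟧-∧ (does (inL? a V ℓ)) _))
                     (⟦⟧-no (inL? a V ℓ ×-dec (suc (lookup m ℓ) ℕ.≟ lookup a ℓ)) (¬admissible ∘ inj₂)))

  ∏-shape : ∀ m → ∏[ ℓ < p ] shape ℓ (lookup m ℓ) ≡ negOnePow (+ ∣ a ∣ᵥ - + ∣ m ∣ᵥ) * ⟦ does (inSt? m a V) ⟧
  ∏-shape m with all? (admissible? m)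
  ... | yes admissible = begin
    ∏[ ℓ < p ] shape ℓ (lookup m ℓ)                   ≡⟨ ∏-cong (λ ℓ → shape-admissible m ℓ (admissible ℓ)) ⟩
    ∏[ ℓ < p ] negOne^ (lookup a ℓ ∸ lookup m ℓ)      ≡⟨ ∏-negOne^ (λ ℓ → lookup a ℓ ∸ lookup m ℓ) ⟩
    negOne^ sum (λ ℓ → lookup a ℓ ∸ lookup m ℓ)      ≡⟨ cong negOne^_ (∣∣ᵥ-∸ m≤a) ⟩
    negOne^ (∣ a ∣ᵥ ∸ ∣ m ∣ᵥ)                         ≡⟨ negOnePow-∸ (∣∣ᵥ-mono-≤ m≤a) ⟨
    negOnePow (+ ∣ a ∣ᵥ - + ∣ m ∣ᵥ)                   ≡⟨ ℤₚ.*-identityʳ _ ⟨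
    negOnePow (+ ∣ a ∣ᵥ - + ∣ m ∣ᵥ) * + 1             ≡⟨ cong (negOnePow (+ ∣ a ∣ᵥ - + ∣ m ∣ᵥ) *_) (⟦⟧-yes (inSt? m a V) m∈St) ⟨
    negOnePow (+ ∣ a ∣ᵥ - + ∣ m ∣ᵥ) * ⟦ does (inSt? m a V) ⟧ ∎
    where
    open ≡-Reasoning
    m∈St : InSt m a V
    m∈St = admissible⇒InSt admissible
    m≤a : m ≤ᵥ a
    m≤a = InSt⇒≤ᵥ m∈St
  ... | no ¬admissible with ¬∀⟶∃¬ p (Admissible m) (admissible? m) ¬admissible
  ...   | ℓ , ¬admissibleℓ = trans (∏-zero (λ ℓ → shape ℓ (lookup m ℓ)) ℓ (shape-inadmissible m ℓ ¬admissibleℓ)) (sym (begin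
    negOnePow (+ ∣ a ∣ᵥ - + ∣ m ∣ᵥ) * ⟦ does (inSt? m a V) ⟧
      ≡⟨ cong (negOnePow (+ ∣ a ∣ᵥ - + ∣ m ∣ᵥ) *_) (⟦⟧-no (inSt? m a V) (λ m∈St → ¬admissibleℓ (InSt⇒admissible m∈St ℓ))) ⟩
    negOnePow (+ ∣ a ∣ᵥ - + ∣ m ∣ᵥ) * + 0
      ≡⟨ ℤₚ.*-zeroʳ (negOnePow (+ ∣ a ∣ᵥ - + ∣ m ∣ᵥ)) ⟩
    + 0 ∎))
    where open ≡-Reasoning

  module _ (n : Vecℕ p) where

    Anchored : Set
    Anchored = n ≤ᵥ a × (∀ ℓ → InL a V ℓ → ¬ lookup n ℓ < lookup a ℓ)

    anchored? : Dec Anchored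
    anchored? = (n ≤ᵥ? a) ×-dec all? (λ ℓ → inL? a V ℓ →-dec ¬? (lookup n ℓ <? lookup a ℓ))

    AnchoredAt : Fin p → Set
    AnchoredAt ℓ = lookup n ℓ ≤ lookup a ℓ × ¬ (InL a V ℓ × lookup n ℓ < lookup a ℓ)

    anchoredAt? : ∀ ℓ → Dec (AnchoredAt ℓ)
    anchoredAt? ℓ = (lookup n ℓ ≤? lookup a ℓ) ×-dec ¬? (inL? a V ℓ ×-dec (lookup n ℓ <? lookup a ℓ))

    factor : Fin p → ℕ → ℤ
    factor ℓ t = ⟦ does (lookup n ℓ ≤? t) ⟧ * shape ℓ t

    summand-∏ : ∀ m → ⟦ does (n ≤ᵥ? m) ⟧ * (negOnePow (+ ∣ a ∣ᵥ - + ∣ m ∣ᵥ) * ⟦ does (inSt? m a V) ⟧) ≡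
                      ∏[ ℓ < p ] factor ℓ (lookup m ℓ)
    summand-∏ m = sym (trans (∏-distrib-* (λ ℓ → ⟦ does (lookup n ℓ ≤? lookup m ℓ) ⟧) (λ ℓ → shape ℓ (lookup m ℓ)))
                             (cong₂ _*_ (∏-⟦⟧ (λ ℓ → lookup n ℓ ≤? lookup m ℓ) (n ≤ᵥ? m) ≤ᵥ-lookup ≤ᵥ-fromLookup) (∏-shape m)))

    factor-sum : ∀ K ℓ → lookup a ℓ ≤ K → ∑ (upTo (suc K)) (factor ℓ) ≡ ⟦ does (anchoredAt? ℓ) ⟧
    factor-sum K ℓ aℓ≤K = begin
      ∑ (upTo (suc K)) (factor ℓ)
        ≡⟨ ∑-cong (upTo (suc K)) (λ t → expand ⟦ does (lookup n ℓ ≤? t) ⟧ ⟦ does (t ℕ.≟ lookup a ℓ) ⟧ L ⟦ does (suc t ℕ.≟ lookup a ℓ) ⟧) ⟩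
      ∑[ t ∈ upTo (suc K) ] (⟦ does (t ℕ.≟ lookup a ℓ) ⟧ * ⟦ does (lookup n ℓ ≤? t) ⟧ + - L * (⟦ does (suc t ℕ.≟ lookup a ℓ) ⟧ * ⟦ does (lookup n ℓ ≤? t) ⟧))
        ≡⟨ ∑-distrib-+ (upTo (suc K)) (λ t → ⟦ does (t ℕ.≟ lookup a ℓ) ⟧ * ⟦ does (lookup n ℓ ≤? t) ⟧)
                                      (λ t → - L * (⟦ does (suc t ℕ.≟ lookup a ℓ) ⟧ * ⟦ does (lookup n ℓ ≤? t) ⟧)) ⟩
      ∑[ t ∈ upTo (suc K) ] (⟦ does (t ℕ.≟ lookup a ℓ) ⟧ * ⟦ does (lookup n ℓ ≤? t) ⟧) +
      ∑[ t ∈ upTo (suc K) ] (- L * (⟦ does (suc t ℕ.≟ lookup a ℓ) ⟧ * ⟦ does (lookup n ℓ ≤? t) ⟧))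
        ≡⟨ cong₂ _+_ (∑-upTo-δ K (λ t → ⟦ does (lookup n ℓ ≤? t) ⟧) aℓ≤K)
                     (trans (sym (*-distribˡ-∑ (- L) (upTo (suc K)) (λ t → ⟦ does (suc t ℕ.≟ lookup a ℓ) ⟧ * ⟦ does (lookup n ℓ ≤? t) ⟧))) (cong (- L *_) (∑-upTo-δ-suc K (lookup n ℓ) aℓ≤K))) ⟩
      ⟦ does (lookup n ℓ ≤? lookup a ℓ) ⟧ + - L * ⟦ does (lookup n ℓ <? lookup a ℓ) ⟧
        ≡⟨ cong (λ z → ⟦ does (lookup n ℓ ≤? lookup a ℓ) ⟧ + z) (ℤₚ.neg-distribˡ-* L _) ⟨
      ⟦ does (lookup n ℓ ≤? lookup a ℓ) ⟧ - L * ⟦ does (lookup n ℓ <? lookup a ℓ) ⟧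
        ≡⟨ ⟦⟧-×-¬× (lookup n ℓ ≤? lookup a ℓ) (inL? a V ℓ) (lookup n ℓ <? lookup a ℓ) ℕₚ.<⇒≤ ⟨
      ⟦ does (anchoredAt? ℓ) ⟧ ∎
      where
      open ≡-Reasoning
      L : ℤ
      L = ⟦ does (inL? a V ℓ) ⟧
      expand : ∀ x d l e → x * (d - l * e) ≡ d * x + - l * (e * x)
      expand = solve-∀

    stalactite-signedSum : ∀ K → (∀ ℓ → lookup a ℓ ≤ K) →
      ∑[ m ∈ box p K ] (⟦ does (n ≤ᵥ? m) ⟧ * (negOnePow (+ ∣ a ∣ᵥ - + ∣ m ∣ᵥ) * ⟦ does (inSt? m a V) ⟧)) ≡ ⟦ does anchored? ⟧
    stalactite-signedSum K a≤K = begin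
      ∑[ m ∈ box p K ] (⟦ does (n ≤ᵥ? m) ⟧ * (negOnePow (+ ∣ a ∣ᵥ - + ∣ m ∣ᵥ) * ⟦ does (inSt? m a V) ⟧))
        ≡⟨ ∑-cong (box p K) summand-∏ ⟩
      ∑[ m ∈ box p K ] ∏[ ℓ < p ] factor ℓ (lookup m ℓ)
        ≡⟨ ∑-box-∏ p K factor ⟩
      ∏[ ℓ < p ] ∑ (upTo (suc K)) (factor ℓ)
        ≡⟨ ∏-cong (λ ℓ → factor-sum K ℓ (a≤K ℓ)) ⟩
      ∏[ ℓ < p ] ⟦ does (anchoredAt? ℓ) ⟧
        ≡⟨ ∏-⟦⟧ anchoredAt? anchored? (λ (n≤a , tight) ℓ → ≤ᵥ-lookup n≤a ℓ , λ (inL , n<a) → tight ℓ inL n<a)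
                                      (λ at → ≤ᵥ-fromLookup (proj₁ ∘ at) , λ ℓ inL n<a → proj₂ (at ℓ) (inL , n<a)) ⟩
      ⟦ does anchored? ⟧ ∎
      where open ≡-Reasoning

    undominated⇒anchored : n ≤ᵥ a → (∀ {b} → b ∈ₗ V → ¬ n ≤ᵥ b) → Anchored
    undominated⇒anchored n≤a undominated = n≤a , tight
      where
      tight : ∀ ℓ → InL a V ℓ → ¬ lookup n ℓ < lookup a ℓ
      tight ℓ (j , j≢ℓ , exchange) nℓ<aℓ with find exchange
      ... | w , w∈V , w≡ = undominated w∈V (≤ᵥ-fromLookup λ t → below t (t ≟ᶠ ℓ))
        where
        below : ∀ t → Dec (t ≡ ℓ) → lookup n t ≤ lookup w t
        below t (yes refl) = ℕₚ.≤-pred (subst (lookup n t <_) (sym (exchange-source w≡ (j≢ℓ ∘ sym))) nℓ<aℓ)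
        below t (no t≢ℓ)   = ℕₚ.≤-trans (≤ᵥ-lookup n≤a t) (exchange-≥ w≡ t≢ℓ)

module StalactiteCounts {p : ℕ} where

  open import Data.Bool using (true; false; if_then_else_)
  open import Data.Integer using (ℤ; +_; _+_; _-_; _*_)
  import Data.Integer.Properties as ℤₚ
  open import Data.Integer.Tactic.RingSolver using (solve-∀)
  open import Data.List using ([]; _∷_; _++_; [_])
  open import Data.List.Membership.Propositional using (_∈_)
  open import Data.List.Relation.Unary.Any using (here; there)
  open import Data.Nat as ℕ using (_≤_)
  open import Data.Vec using (lookup)
  open import Function using (_∘_)
  open import Relation.Nullary using (¬_; does)
  open import Relation.Nullary.Decidable using (dec-false)
  open import Relation.Binary.PropositionalEquality hiding ([_])
  open IntegerSums
  open Stalactites using (anchored?; InSt⇒≤ᵥ; stalactite-signedSum)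

  stalCountFrom-zero : ∀ (m : Vecℕ p) prev as → (∀ {a} → a ∈ as → ¬ m ≤ᵥ a) → stalCountFrom m prev as ≡ 0
  stalCountFrom-zero m prev []       _         = refl
  stalCountFrom-zero m prev (a ∷ as) undominated
    rewrite dec-false (inSt? m a prev) (undominated (here refl) ∘ InSt⇒≤ᵥ a prev)
    = stalCountFrom-zero m (prev ++ [ a ]) as (undominated ∘ there)

  +-indicator : ∀ b k → + ((if b then 1 else 0) ℕ.+ k) ≡ ⟦ b ⟧ + + k
  +-indicator true  k = refl
  +-indicator false k = refl

  anchoredCount : Vecℕ p → List (Vecℕ p) → List (Vecℕ p) → ℤ
  anchoredCount n prev []       = + 0
  anchoredCount n prev (a ∷ as) = ⟦ does (anchored? a prev n) ⟧ + anchoredCount n (prev ++ [ a ]) as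

  ∑-stalCountFrom : ∀ R K (n : Vecℕ p) prev as →
    (∀ {a} → a ∈ as → ∣ a ∣ᵥ ≡ R) → (∀ {a} → a ∈ as → ∀ ℓ → lookup a ℓ ≤ K) →
    ∑[ m ∈ box p K ] (⟦ does (n ≤ᵥ? m) ⟧ * (negOnePow (+ R - + ∣ m ∣ᵥ) * + stalCountFrom m prev as)) ≡ anchoredCount n prev as
  ∑-stalCountFrom R K n prev [] _ _ = ∑-zero (box p K) λ m →
    trans (cong (⟦ does (n ≤ᵥ? m) ⟧ *_) (ℤₚ.*-zeroʳ (negOnePow (+ R - + ∣ m ∣ᵥ)))) (ℤₚ.*-zeroʳ ⟦ does (n ≤ᵥ? m) ⟧)
  ∑-stalCountFrom R K n prev (a ∷ as) rank bounded = begin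
    ∑[ m ∈ box p K ] (⟦ does (n ≤ᵥ? m) ⟧ * (sign m * + stalCountFrom m prev (a ∷ as)))
      ≡⟨ ∑-cong (box p K) split ⟩
    ∑[ m ∈ box p K ] (⟦ does (n ≤ᵥ? m) ⟧ * (sign m * ⟦ does (inSt? m a prev) ⟧) + rest m)
      ≡⟨ ∑-distrib-+ (box p K) _ rest ⟩
    ∑[ m ∈ box p K ] (⟦ does (n ≤ᵥ? m) ⟧ * (sign m * ⟦ does (inSt? m a prev) ⟧)) + ∑ (box p K) rest
      ≡⟨ cong₂ _+_ (trans (∑-cong (box p K) (λ m → cong (λ r → ⟦ does (n ≤ᵥ? m) ⟧ * (negOnePow (+ r - + ∣ m ∣ᵥ) * ⟦ does (inSt? m a prev) ⟧)) (sym (rank (here refl)))))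
                          (stalactite-signedSum a prev n K (bounded (here refl))))
                   (∑-stalCountFrom R K n (prev ++ [ a ]) as (rank ∘ there) (bounded ∘ there)) ⟩
    anchoredCount n prev (a ∷ as) ∎
    where
    open ≡-Reasoning
    sign : Vecℕ p → ℤ
    sign m = negOnePow (+ R - + ∣ m ∣ᵥ)
    rest : Vecℕ p → ℤ
    rest m = ⟦ does (n ≤ᵥ? m) ⟧ * (sign m * + stalCountFrom m (prev ++ [ a ]) as)
    distrib : ∀ x s y z → x * (s * (y + z)) ≡ x * (s * y) + x * (s * z)
    distrib = solve-∀
    split : ∀ m → ⟦ does (n ≤ᵥ? m) ⟧ * (sign m * + stalCountFrom m prev (a ∷ as)) ≡
                  ⟦ does (n ≤ᵥ? m) ⟧ * (sign m * ⟦ does (inSt? m a prev) ⟧) + rest m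
    split m = trans (cong (λ z → ⟦ does (n ≤ᵥ? m) ⟧ * (sign m * z)) (+-indicator (does (inSt? m a prev)) _))
                    (distrib ⟦ does (n ≤ᵥ? m) ⟧ (sign m) ⟦ does (inSt? m a prev) ⟧ (+ stalCountFrom m (prev ++ [ a ]) as))

module LexOrder {p : ℕ} (σ : Permutation′ p) where

  open import Data.Empty using (⊥-elim)
  open import Data.Fin using (toℕ)
  open import Data.Fin.Permutation using (_⟨$⟩ʳ_; _⟨$⟩ˡ_; inverseˡ)
  open import Data.Fin.Properties using (toℕ-injective)
  open import Data.Integer using (+_; _+_)
  import Data.Integer.Properties as ℤₚ
  open import Data.List using ([]; _∷_; _++_; [_])
  import Data.List.Properties as Listₚ
  open import Data.List.Membership.Propositional using (_∈_; lose)
  open import Data.List.Membership.Propositional.Properties using (∈-++⁻; ∈-++⁺ˡ; ∈-++⁺ʳ)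
  import Data.List.Relation.Unary.All as All
  open import Data.List.Relation.Unary.Any as Any using (Any; here; there)
  open import Data.List.Relation.Unary.AllPairs using ([]; _∷_)
  open import Data.Nat using (_<_)
  import Data.Nat.Properties as ℕₚ
  open import Data.Product using (∃-syntax; _×_; _,_; proj₁)
  open import Data.Sum using (inj₁; inj₂)
  open import Function using (_∘_)
  open import Relation.Binary using (tri<; tri≈; tri>)
  open import Relation.Nullary using (¬_; Dec; yes; no; does)
  open import Relation.Binary.PropositionalEquality hiding ([_])
  open import Data.Vec using (lookup)
  open Coordinates
  open IntegerSums
  open Stalactites using (Anchored; anchored?; undominated⇒anchored)
  open StalactiteCounts using (anchoredCount)

  _≺_ : Vecℕ p → Vecℕ p → Set
  _≺_ = LexLt σ

  ≺-irrefl : ∀ {u} → ¬ u ≺ u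
  ≺-irrefl (_ , _ , u<u) = ℕₚ.<-irrefl refl u<u

  ≺-asym : ∀ {u v} → u ≺ v → ¬ v ≺ u
  ≺-asym (k , u≐v , u<v) (k′ , v≐u , v<u) with ℕₚ.<-cmp (toℕ k) (toℕ k′)
  ... | tri< k<k′ _ _ = ℕₚ.<-irrefl (sym (v≐u k k<k′)) u<v
  ... | tri≈ _ k≡k′ _ rewrite toℕ-injective k≡k′ = ℕₚ.<-asym u<v v<u
  ... | tri> _ _ k′<k = ℕₚ.<-irrefl (sym (u≐v k′ k′<k)) v<u

  AllPairs-++ : ∀ {xs ys : List (Vecℕ p)} → AllPairs _≺_ (xs ++ ys) → ∀ {x y} → x ∈ xs → y ∈ ys → x ≺ y
  AllPairs-++ {_ ∷ xs} (x≺ ∷ _)      (here refl) y∈ys = All.lookup x≺ (∈-++⁺ʳ xs y∈ys)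
  AllPairs-++ {_ ∷ xs} (_ ∷ sorted) (there x∈xs) y∈ys = AllPairs-++ sorted x∈xs y∈ys

  module _ (P : List (Vecℕ p)) (sorted : AllPairs _≺_ P) (mConvex : MConvex P) where

    ≺-prefix : ∀ prev {a} as → prev ++ a ∷ as ≡ P → ∀ {w} → w ∈ P → w ≺ a → w ∈ prev
    ≺-prefix prev {a} as refl {w} w∈P w≺a with ∈-++⁻ prev w∈P
    ... | inj₁ w∈prev       = w∈prev
    ... | inj₂ (here refl)  = ⊥-elim (≺-irrefl {w} w≺a)
    ... | inj₂ (there w∈as) = ⊥-elim (≺-asym {w} {a} w≺a (AllPairs-++ {prev ++ [ a ]} (subst (AllPairs _≺_) (sym (Listₚ.++-assoc prev [ a ] as)) sorted)
                                                              (∈-++⁺ʳ prev (here refl)) w∈as))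

    -- Exchanging a towards b at their first lexicographic difference gives an element of P
    -- lexicographically below a, hence one of the elements preceding a.
    earlier⇒descent : ∀ prev {a} as → prev ++ a ∷ as ≡ P → ∀ {b} → b ∈ prev →
      ∃[ ℓ ] (InL a prev ℓ × lookup b ℓ < lookup a ℓ)
    earlier⇒descent prev {a} as refl {b} b∈prev with AllPairs-++ sorted b∈prev (here refl)
    ... | k , b≐a , bk<ak with mConvex (∈-++⁺ʳ prev (here refl)) (∈-++⁺ˡ b∈prev) (σ ⟨$⟩ʳ k) bk<ak
    ...   | j , aj<bj , w , w∈P , w≡ = σ ⟨$⟩ʳ k , (j , j≢σk , lose (≺-prefix prev as refl w∈P w≺a) w≡) , bk<ak
      where
      j≢σk : j ≢ σ ⟨$⟩ʳ k
      j≢σk refl = ℕₚ.<-asym aj<bj bk<ak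
      σ-injective : ∀ {i} → σ ⟨$⟩ʳ i ≡ σ ⟨$⟩ʳ k → i ≡ k
      σ-injective eq = trans (sym (inverseˡ σ)) (trans (cong (σ ⟨$⟩ˡ_) eq) (inverseˡ σ))
      w≺a : w ≺ a
      w≺a = k , (λ i i<k → exchange-other w≡ (λ eq → ℕₚ.<-irrefl (cong toℕ (σ-injective eq)) i<k)
                                             (λ { refl → ℕₚ.<-irrefl (sym (b≐a i i<k)) aj<bj }))
              , subst (lookup w (σ ⟨$⟩ʳ k) <_) (exchange-source w≡ (j≢σk ∘ sym)) (ℕₚ.n<1+n _)

    anchoredCount-dominated : ∀ n prev as → prev ++ as ≡ P → ∀ {b} → b ∈ prev → n ≤ᵥ b → anchoredCount n prev as ≡ + 0
    anchoredCount-dominated n prev []       _  _      _   = refl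
    anchoredCount-dominated n prev (a ∷ as) eq b∈prev n≤b =
      cong₂ _+_ (⟦⟧-no (anchored? a prev n) not-anchored)
                (anchoredCount-dominated n (prev ++ [ a ]) as (trans (Listₚ.++-assoc prev [ a ] as) eq) (∈-++⁺ˡ b∈prev) n≤b)
      where
      not-anchored : ¬ Anchored a prev n
      not-anchored (_ , tight) with earlier⇒descent prev as eq b∈prev
      ... | ℓ , inL , bℓ<aℓ = tight ℓ inL (ℕₚ.≤-<-trans (≤ᵥ-lookup n≤b ℓ) bℓ<aℓ)

    anchoredCount-undominated : ∀ n prev as → prev ++ as ≡ P → (∀ {b} → b ∈ prev → ¬ n ≤ᵥ b) →
      anchoredCount n prev as ≡ ⟦ does (Any.any? (n ≤ᵥ?_) as) ⟧
    anchoredCount-undominated n prev []       _  _           = refl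
    anchoredCount-undominated n prev (a ∷ as) eq undominated = by-cases (n ≤ᵥ? a)
      where
      eq′ : (prev ++ [ a ]) ++ as ≡ P
      eq′ = trans (Listₚ.++-assoc prev [ a ] as) eq
      by-cases : Dec (n ≤ᵥ a) → anchoredCount n prev (a ∷ as) ≡ ⟦ does (Any.any? (n ≤ᵥ?_) (a ∷ as)) ⟧
      by-cases (yes n≤a) =
        trans (cong₂ _+_ (⟦⟧-yes (anchored? a prev n) (undominated⇒anchored a prev n n≤a undominated))
                         (anchoredCount-dominated n (prev ++ [ a ]) as eq′ (∈-++⁺ʳ prev (here refl)) n≤a))
              (sym (⟦⟧-yes (Any.any? (n ≤ᵥ?_) (a ∷ as)) (here n≤a)))
      by-cases (no n≰a) =
        trans (cong₂ _+_ (⟦⟧-no (anchored? a prev n) (n≰a ∘ proj₁))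
                         (anchoredCount-undominated n (prev ++ [ a ]) as eq′ undominated′))
              (trans (ℤₚ.+-identityˡ _)
                     (⟦⟧-⇔ (Any.any? (n ≤ᵥ?_) as) (Any.any? (n ≤ᵥ?_) (a ∷ as)) there
                           λ { (here n≤a) → ⊥-elim (n≰a n≤a) ; (there dominated) → dominated }))
        where
        undominated′ : ∀ {b} → b ∈ prev ++ [ a ] → ¬ n ≤ᵥ b
        undominated′ b∈ with ∈-++⁻ prev b∈
        ... | inj₁ b∈prev      = undominated b∈prev
        ... | inj₂ (here refl) = n≰a

module MöbiusInversion {p : ℕ} (P : List (Vecℕ p)) (μ : Elt p → Elt p → ℤ) (isMobius : IsMobius P μ)
                       (inI? : ∀ m → Dec (InI P m)) (inI⇒inBox : ∀ m → InI P m → ∀ ℓ → lookup m ℓ Data.Nat.≤ rk P) where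

  open import Data.Integer using (+_; -_; _+_; _-_; _*_)
  import Data.Integer.Properties as ℤₚ
  open import Data.Integer.Tactic.RingSolver using (solve-∀)
  open import Data.List using ([]; _∷_; map)
  open import Data.Maybe using (just; nothing)
  open import Data.Maybe.Properties using (just-injective)
  open import Data.Product using (_×_; _,_; proj₁; proj₂)
  open import Data.Sum using (_⊎_; inj₁; inj₂)
  open import Data.Unit using (tt)
  open import Data.Empty using (⊥-elim)
  open import Function using (_∘_)
  open import Relation.Nullary using (¬_; yes; no; does; ¬?; _×-dec_)
  open import Relation.Binary.PropositionalEquality
  open Coordinates
  open IntegerSums

  Splits : ∀ {A : Set} → (A → Set) → (A → ℤ) → (A → ℤ) → A → Set
  Splits Q c f x = (Q x × c x ≡ f x) ⊎ (¬ Q x × c x ≡ + 0)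

  SumWhere-∑ : ∀ {A : Set} {Q : A → Set} (f c : A → ℤ) xs → (∀ x → Splits Q c f x) →
    SumWhere Q f xs (∑ xs c)
  SumWhere-∑ f c []       _     = sw-[]
  SumWhere-∑ {Q = Q} f c (x ∷ xs) cases with cases x
  ... | inj₁ (q  , cx≡fx) = subst (SumWhere Q f (x ∷ xs)) (cong (_+ ∑ xs c) (sym cx≡fx)) (sw-yes q (SumWhere-∑ f c xs cases))
  ... | inj₂ (¬q , cx≡0)  = subst (SumWhere Q f (x ∷ xs)) (sym (trans (cong (_+ ∑ xs c) cx≡0) (ℤₚ.+-identityˡ _)))
                                  (sw-no ¬q (SumWhere-∑ f c xs cases))

  ⟦⟧*-cases : ∀ {A : Set} (d : Dec A) v → (A × ⟦ does d ⟧ * v ≡ v) ⊎ (¬ A × ⟦ does d ⟧ * v ≡ + 0)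
  ⟦⟧*-cases (yes a) v = inj₁ (a , ℤₚ.*-identityˡ v)
  ⟦⟧*-cases (no ¬a) v = inj₂ (¬a , refl)

  Between : Elt p → Elt p → Elt p → Set
  Between x y z = Carrier P z × x ≤̂ z × z ≤̂ y × z ≢ y

  B : List (Vecℕ p)
  B = box p (rk P)

  ∑-enumElt : ∀ (c : Elt p → ℤ) → c nothing ≡ + 0 → ∑ (enumElt P) c ≡ ∑[ m ∈ B ] c (just m)
  ∑-enumElt c c-top≡0 = trans (cong (_+ ∑ (map just B) c) c-top≡0) (trans (ℤₚ.+-identityˡ _) (∑-map just B c))

  module _ {n : Vecℕ p} (n∈I : InI P n) where

    interval : Vecℕ p → ℤ
    interval m = ⟦ does (inI? m ×-dec (n ≤ᵥ? m)) ⟧ * μ (just n) (just m)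

    interval-cases : ∀ m → Splits (λ m → InI P m × n ≤ᵥ m) interval (μ (just n) ∘ just) m
    interval-cases m = ⟦⟧*-cases (inI? m ×-dec (n ≤ᵥ? m)) (μ (just n) (just m))

    μ-top : μ (just n) nothing ≡ - ∑ B interval
    μ-top = trans (proj₂ (isMobius (just n) nothing n∈I tt tt) (λ ()) (∑ (enumElt P) c) (SumWhere-∑ (μ (just n)) c (enumElt P) cases))
                  (cong -_ (∑-enumElt c refl))
      where
      c : Elt p → ℤ
      c nothing  = + 0
      c (just m) = interval m
      cases : ∀ z → Splits (Between (just n) nothing) c (μ (just n)) z
      cases nothing = inj₂ ((λ (_ , _ , _ , z≢top) → z≢top refl) , refl)
      cases (just m) = top-cases (interval-cases m)
        where
        top-cases : Splits (λ m → InI P m × n ≤ᵥ m) interval (μ (just n) ∘ just) m →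
                    Splits (Between (just n) nothing) c (μ (just n)) (just m)
        top-cases (inj₁ ((m∈I , n≤m) , eq)) = inj₁ ((m∈I , n≤m , tt , λ ()) , eq)
        top-cases (inj₂ (¬[m∈I×n≤m] , eq)) = inj₂ ((λ (m∈I , n≤m , _) → ¬[m∈I×n≤m] (m∈I , n≤m)) , eq)

    strictlyBelow : Vecℕ p → Vecℕ p → ℤ
    strictlyBelow w m = ⟦ does ((m ≤ᵥ? w) ×-dec ¬? (m ≟ᵥ w)) ⟧ * interval m

    below-split : ∀ w m → ⟦ does (m ≤ᵥ? w) ⟧ * interval m ≡ strictlyBelow w m + ⟦ does (m ≟ᵥ w) ⟧ * interval m
    below-split w m = trans (rearrange ⟦ does (m ≤ᵥ? w) ⟧ ⟦ does (m ≟ᵥ w) ⟧ (interval m))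
                            (cong (λ x → x * interval m + ⟦ does (m ≟ᵥ w) ⟧ * interval m)
                                  (sym (⟦⟧-×-¬ (m ≤ᵥ? w) (m ≟ᵥ w) (λ { refl → ≤ᵥ-refl }))))
      where
      rearrange : ∀ x z v → x * v ≡ (x - z) * v + z * v
      rearrange = solve-∀

    strictlyBelow-self : ∀ m → strictlyBelow n m ≡ + 0
    strictlyBelow-self m = vanishes ((m ≤ᵥ? n) ×-dec ¬? (m ≟ᵥ n))
      where
      vanishes : (d : Dec (m ≤ᵥ n × m ≢ n)) → ⟦ does d ⟧ * interval m ≡ + 0
      vanishes (no _)            = ℤₚ.*-zeroˡ (interval m)
      vanishes (yes (m≤n , m≢n)) = trans (ℤₚ.*-identityˡ _) (cong (_* μ (just n) (just m))
        (⟦⟧-no (inI? m ×-dec (n ≤ᵥ? m)) (λ (_ , n≤m) → m≢n (≤ᵥ-antisym m≤n n≤m))))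

    μ-strictlyBelow : ∀ {w} → InI P w → n ≤ᵥ w → w ≢ n → μ (just n) (just w) ≡ - ∑ B (strictlyBelow w)
    μ-strictlyBelow {w} w∈I n≤w w≢n =
      trans (proj₂ (isMobius (just n) (just w) n∈I w∈I n≤w) (w≢n ∘ sym ∘ just-injective) (∑ (enumElt P) c)
                   (SumWhere-∑ (μ (just n)) c (enumElt P) cases))
            (cong -_ (∑-enumElt c refl))
      where
      c : Elt p → ℤ
      c nothing  = + 0
      c (just m) = strictlyBelow w m
      cases : ∀ z → Splits (Between (just n) (just w)) c (μ (just n)) z
      cases nothing  = inj₂ ((λ { (_ , _ , () , _) }) , refl)
      cases (just m) = strict-cases (⟦⟧*-cases ((m ≤ᵥ? w) ×-dec ¬? (m ≟ᵥ w)) (interval m)) (interval-cases m)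
        where
        strict-cases : Splits (λ m → m ≤ᵥ w × m ≢ w) (strictlyBelow w) interval m →
                       Splits (λ m → InI P m × n ≤ᵥ m) interval (μ (just n) ∘ just) m →
                       Splits (Between (just n) (just w)) c (μ (just n)) (just m)
        strict-cases (inj₂ (¬strict , eq)) _ = inj₂ ((λ (_ , _ , m≤w , m≢w) → ¬strict (m≤w , m≢w ∘ cong just)) , eq)
        strict-cases (inj₁ ((m≤w , m≢w) , eq)) (inj₁ ((m∈I , n≤m) , eq′)) =
          inj₁ ((m∈I , n≤m , m≤w , m≢w ∘ just-injective) , trans eq eq′)
        strict-cases (inj₁ (_ , eq)) (inj₂ (¬[m∈I×n≤m] , eq′)) =
          inj₂ ((λ (m∈I , n≤m , _) → ¬[m∈I×n≤m] (m∈I , n≤m)) , trans eq eq′)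

    ∑-below : ∀ {w} → InI P w → n ≤ᵥ w → ∑[ m ∈ B ] (⟦ does (m ≤ᵥ? w) ⟧ * interval m) ≡ ⟦ does (w ≟ᵥ n) ⟧
    ∑-below {w} w∈I n≤w = begin
      ∑[ m ∈ B ] (⟦ does (m ≤ᵥ? w) ⟧ * interval m)                          ≡⟨ ∑-cong B (below-split w) ⟩
      ∑[ m ∈ B ] (strictlyBelow w m + ⟦ does (m ≟ᵥ w) ⟧ * interval m)      ≡⟨ ∑-distrib-+ B (strictlyBelow w) _ ⟩
      ∑ B (strictlyBelow w) + ∑[ m ∈ B ] (⟦ does (m ≟ᵥ w) ⟧ * interval m)
        ≡⟨ cong (λ x → ∑ B (strictlyBelow w) + x) (∑-box-δ p (rk P) interval w (inI⇒inBox w w∈I)) ⟩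
      ∑ B (strictlyBelow w) + interval w
        ≡⟨ cong (λ x → ∑ B (strictlyBelow w) + x) (trans (cong (_* μ (just n) (just w)) (⟦⟧-yes (inI? w ×-dec (n ≤ᵥ? w)) (w∈I , n≤w)))
                                                           (ℤₚ.*-identityˡ _)) ⟩
      ∑ B (strictlyBelow w) + μ (just n) (just w)                            ≡⟨ by-cases (w ≟ᵥ n) ⟩
      ⟦ does (w ≟ᵥ n) ⟧                                                      ∎
      where
      open ≡-Reasoning
      by-cases : Dec (w ≡ n) → ∑ B (strictlyBelow w) + μ (just n) (just w) ≡ ⟦ does (w ≟ᵥ n) ⟧
      by-cases (yes refl) = trans (cong₂ _+_ (∑-zero B strictlyBelow-self) (proj₁ (isMobius (just n) (just n) n∈I n∈I ≤ᵥ-refl) refl))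
                                  (sym (⟦⟧-yes (n ≟ᵥ n) refl))
      by-cases (no w≢n)   = trans (cong (λ x → ∑ B (strictlyBelow w) + x) (μ-strictlyBelow w∈I n≤w w≢n))
                                  (trans (ℤₚ.+-inverseʳ (∑ B (strictlyBelow w))) (sym (⟦⟧-no (w ≟ᵥ n) w≢n)))

    ∑-below-¬ : ∀ {w} → ¬ n ≤ᵥ w → ∑[ m ∈ B ] (⟦ does (m ≤ᵥ? w) ⟧ * interval m) ≡ + 0
    ∑-below-¬ {w} n≰w = ∑-zero B λ m → vanishes m (m ≤ᵥ? w) (interval-cases m)
      where
      vanishes : ∀ m (d : Dec (m ≤ᵥ w)) → Splits (λ m → InI P m × n ≤ᵥ m) interval (μ (just n) ∘ just) m →
                 ⟦ does d ⟧ * interval m ≡ + 0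
      vanishes m (no _)    _                       = refl
      vanishes m (yes m≤w) (inj₁ ((_ , n≤m) , _)) = ⊥-elim (n≰w (≤ᵥ-trans n≤m m≤w))
      vanishes m (yes _)   (inj₂ (_ , eq))         = trans (ℤₚ.*-identityˡ _) eq

    unitUpwardSums⇒≡-μ : ∀ (c : Vecℕ p → ℤ) → (∀ m → ¬ InI P m → c m ≡ + 0) →
      (∀ m → InI P m → ∑[ w ∈ B ] (⟦ does (m ≤ᵥ? w) ⟧ * c w) ≡ + 1) → c n ≡ - μ (just n) nothing
    unitUpwardSums⇒≡-μ c c-outside c-upward = begin
      c n                                                                   ≡⟨ ∑-box-δ p (rk P) c n (inI⇒inBox n n∈I) ⟨
      ∑[ w ∈ B ] (⟦ does (w ≟ᵥ n) ⟧ * c w)                                  ≡⟨ ∑-cong B (λ w → weigh w (inI? w)) ⟩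
      ∑[ w ∈ B ] (c w * ∑[ m ∈ B ] (⟦ does (m ≤ᵥ? w) ⟧ * interval m))       ≡⟨ ∑-cong B (λ w → *-distribˡ-∑ (c w) B _) ⟩
      ∑[ w ∈ B ] ∑[ m ∈ B ] (c w * (⟦ does (m ≤ᵥ? w) ⟧ * interval m))       ≡⟨ ∑-comm B B _ ⟩
      ∑[ m ∈ B ] ∑[ w ∈ B ] (c w * (⟦ does (m ≤ᵥ? w) ⟧ * interval m))       ≡⟨ ∑-cong B (λ m → ∑-cong B (λ w → rearrange (c w) ⟦ does (m ≤ᵥ? w) ⟧ (interval m))) ⟩
      ∑[ m ∈ B ] ∑[ w ∈ B ] (interval m * (⟦ does (m ≤ᵥ? w) ⟧ * c w))       ≡⟨ ∑-cong B (λ m → *-distribˡ-∑ (interval m) B _) ⟨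
      ∑[ m ∈ B ] (interval m * ∑[ w ∈ B ] (⟦ does (m ≤ᵥ? w) ⟧ * c w))       ≡⟨ ∑-cong B (λ m → upward m (interval-cases m)) ⟩
      ∑ B interval                                                          ≡⟨ ℤₚ.neg-involutive _ ⟨
      - - ∑ B interval                                                      ≡⟨ cong -_ μ-top ⟨
      - μ (just n) nothing                                                  ∎
      where
      open ≡-Reasoning
      rearrange : ∀ x y z → x * (y * z) ≡ z * (y * x)
      rearrange = solve-∀
      below : Vecℕ p → ℤ
      below w = ∑[ m ∈ B ] (⟦ does (m ≤ᵥ? w) ⟧ * interval m)
      weigh : ∀ w → Dec (InI P w) → ⟦ does (w ≟ᵥ n) ⟧ * c w ≡ c w * below w
      weigh w (no w∉I) = begin
        ⟦ does (w ≟ᵥ n) ⟧ * c w   ≡⟨ cong (⟦ does (w ≟ᵥ n) ⟧ *_) (c-outside w w∉I) ⟩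
        ⟦ does (w ≟ᵥ n) ⟧ * + 0   ≡⟨ ℤₚ.*-zeroʳ ⟦ does (w ≟ᵥ n) ⟧ ⟩
        + 0                       ≡⟨ ℤₚ.*-zeroˡ (below w) ⟨
        + 0 * below w             ≡⟨ cong (_* below w) (c-outside w w∉I) ⟨
        c w * below w             ∎
      weigh w (yes w∈I) with n ≤ᵥ? w
      ... | yes n≤w = trans (ℤₚ.*-comm _ (c w)) (cong (c w *_) (sym (∑-below w∈I n≤w)))
      ... | no n≰w  = trans (cong (_* c w) (⟦⟧-no (w ≟ᵥ n) λ { refl → n≰w ≤ᵥ-refl }))
                            (sym (trans (cong (c w *_) (∑-below-¬ n≰w)) (ℤₚ.*-zeroʳ (c w))))
      upward : ∀ m → Splits (λ m → InI P m × n ≤ᵥ m) interval (μ (just n) ∘ just) m →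
               interval m * ∑[ w ∈ B ] (⟦ does (m ≤ᵥ? w) ⟧ * c w) ≡ interval m
      upward m (inj₁ ((m∈I , _) , _)) = trans (cong (interval m *_) (c-upward m m∈I)) (ℤₚ.*-identityʳ _)
      upward m (inj₂ (_ , eq))        = trans (cong (_* _) eq) (sym eq)

module Coefficients {p : ℕ} (σ : Permutation′ p) (P : List (Vecℕ p)) (sorted : AllPairs (LexLt σ) P)
                    (sameRank : SameRank P) (mConvex : MConvex P) where

  open import Data.Bool using (true)
  open import Data.Integer using (+_; _+_; _-_; _*_)
  import Data.Integer.Properties as ℤₚ
  open import Data.Integer.Tactic.RingSolver using (solve-∀)
  open import Data.List using ([])
  open import Data.List.Membership.Propositional using (_∈_; find; lose)
  import Data.List.Relation.Unary.Any as Any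
  open import Data.Nat as ℕ using (_≤_)
  import Data.Nat.Properties as ℕₚ
  open import Data.Product using (∃-syntax; _×_; _,_)
  open import Data.Vec using (lookup)
  open import Function using (_∘_)
  open import Relation.Nullary using (¬_; Dec; yes; no; does; ¬?; _×-dec_)
  open import Relation.Nullary.Decidable using (map′)
  open import Relation.Binary.PropositionalEquality
  open Coordinates
  open NatSums
  open ConvexCombinations
  open IntegerSums
  open StalactiteCounts
  open LexOrder σ using (anchoredCount-undominated)

  B : List (Vecℕ p)
  B = box p (rk P)

  rk≡∣∣ᵥ : ∀ {a} → a ∈ P → rk P ≡ ∣ a ∣ᵥ
  rk≡∣∣ᵥ = Polymatroids.sameRank⇒rk≡∣∣ᵥ sameRank

  inBox : ∀ {a} → a ∈ P → ∀ ℓ → lookup a ℓ ≤ rk P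
  inBox {a} a∈P ℓ = subst (lookup a ℓ ≤_) (sym (rk≡∣∣ᵥ a∈P)) (lookup≤∣∣ᵥ a ℓ)

  InI⇒dominated : ∀ n → InI P n → ∃[ a ] (a ∈ P × n ≤ᵥ a)
  InI⇒dominated n n∈I with InI⇒nonempty P n n∈I
  ... | _ , a∈P = Polymatroids.rankBounded⇒dominated P sameRank mConvex a∈P (InI⇒rankBounded P n n∈I)

  inI? : ∀ m → Dec (InI P m)
  inI? m = map′ (λ dominated → let (_ , a∈P , m≤a) = find dominated in dominated⇒InI a∈P m≤a)
                (λ m∈I → let (_ , a∈P , m≤a) = InI⇒dominated m m∈I in lose a∈P m≤a)
                (Any.any? (m ≤ᵥ?_) P)

  InI⇒inBox : ∀ m → InI P m → ∀ ℓ → lookup m ℓ ≤ rk P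
  InI⇒inBox m m∈I ℓ with InI⇒dominated m m∈I
  ... | a , a∈P , m≤a = ℕₚ.≤-trans (≤ᵥ-lookup m≤a ℓ) (inBox a∈P ℓ)

  c′-outside : ∀ n → ¬ InI P n → c′ P n ≡ + 0
  c′-outside n n∉I = trans (cong (λ k → negOnePow (+ rk P - + ∣ n ∣ᵥ) * + k)
                                 (stalCountFrom-zero n [] P (λ a∈P n≤a → n∉I (dominated⇒InI a∈P n≤a))))
                           (ℤₚ.*-zeroʳ (negOnePow (+ rk P - + ∣ n ∣ᵥ)))

  c′-upward : ∀ n → InI P n → ∑[ m ∈ B ] (⟦ does (n ≤ᵥ? m) ⟧ * c′ P m) ≡ + 1
  c′-upward n n∈I with InI⇒dominated n n∈I
  ... | a , a∈P , n≤a = begin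
    ∑[ m ∈ B ] (⟦ does (n ≤ᵥ? m) ⟧ * c′ P m)          ≡⟨ ∑-stalCountFrom (rk P) (rk P) n [] P (sym ∘ rk≡∣∣ᵥ) inBox ⟩
    anchoredCount n [] P                              ≡⟨ anchoredCount-undominated P sorted mConvex n [] P refl (λ ()) ⟩
    ⟦ does (Any.any? (n ≤ᵥ?_) P) ⟧                    ≡⟨ ⟦⟧-yes (Any.any? (n ≤ᵥ?_) P) (lose a∈P n≤a) ⟩
    + 1                                               ∎
    where open ≡-Reasoning

  sumAbove+c′ : ∀ n → InI P n → sumAbove P n + c′ P n ≡ ∑[ m ∈ B ] (⟦ does (n ≤ᵥ? m) ⟧ * c′ P m)
  sumAbove+c′ n n∈I = begin
    sumAbove P n + c′ P n
      ≡⟨ cong₂ _+_ (∑-filter (λ m → (n ≤ᵥ? m) ×-dec ¬? (m ≟ᵥ n)) B (c′ P)) (sym (∑-box-δ p (rk P) (c′ P) n (InI⇒inBox n n∈I))) ⟩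
    ∑[ m ∈ B ] (⟦ does ((n ≤ᵥ? m) ×-dec ¬? (m ≟ᵥ n)) ⟧ * c′ P m) + ∑[ m ∈ B ] (⟦ does (m ≟ᵥ n) ⟧ * c′ P m)
      ≡⟨ ∑-distrib-+ B _ _ ⟨
    ∑[ m ∈ B ] (⟦ does ((n ≤ᵥ? m) ×-dec ¬? (m ≟ᵥ n)) ⟧ * c′ P m + ⟦ does (m ≟ᵥ n) ⟧ * c′ P m)
      ≡⟨ ∑-cong B merge ⟩
    ∑[ m ∈ B ] (⟦ does (n ≤ᵥ? m) ⟧ * c′ P m) ∎
    where
    open ≡-Reasoning
    rearrange : ∀ x z v → (x - z) * v + z * v ≡ x * v
    rearrange = solve-∀
    merge : ∀ m → ⟦ does ((n ≤ᵥ? m) ×-dec ¬? (m ≟ᵥ n)) ⟧ * c′ P m + ⟦ does (m ≟ᵥ n) ⟧ * c′ P m ≡ ⟦ does (n ≤ᵥ? m) ⟧ * c′ P m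
    merge m = trans (cong (λ x → x * c′ P m + ⟦ does (m ≟ᵥ n) ⟧ * c′ P m) (⟦⟧-×-¬ (n ≤ᵥ? m) (m ≟ᵥ n) λ { refl → ≤ᵥ-refl }))
                    (rearrange ⟦ does (n ≤ᵥ? m) ⟧ ⟦ does (m ≟ᵥ n) ⟧ (c′ P m))

  c′-inI : ∀ n → InI P n → c′ P n ≡ + 1 - sumAbove P n
  c′-inI n n∈I = begin
    c′ P n                              ≡⟨ solve-sub (c′ P n) (sumAbove P n) ⟩
    (sumAbove P n + c′ P n) - sumAbove P n ≡⟨ cong (_- sumAbove P n) (trans (sumAbove+c′ n n∈I) (c′-upward n n∈I)) ⟩
    + 1 - sumAbove P n                  ∎
    where
    open ≡-Reasoning
    solve-sub : ∀ x y → x ≡ (y + x) - y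
    solve-sub = solve-∀

  c′-inB : ∀ n → InB P n → c′ P n ≡ + 1
  c′-inB n n∈B = trans (c′-inI n (InB⇒InI P n n∈B)) (cong (λ x → + 1 - x) sumAbove≡0)
    where
    rk≤∣n∣ : rk P ≤ ∣ n ∣ᵥ
    rk≤∣n∣ = subst (rk P ≤_) (sym (∣∣ᵥ≡sum n)) (InB⇒weight≥ P n n∈B (λ _ → true) (rk P)
               (λ {b} b∈P → subst (rk P ≤_) (∣∣ᵥ≡sum b) (ℕₚ.≤-reflexive (rk≡∣∣ᵥ b∈P))))
    strictly-above-outside : ∀ m → n ≤ᵥ m → m ≢ n → ¬ InI P m
    strictly-above-outside m n≤m m≢n m∈I with InI⇒dominated m m∈I
    ... | a , a∈P , m≤a = ℕₚ.<-irrefl refl (ℕₚ.<-≤-trans (∣∣ᵥ-mono-< n≤m (m≢n ∘ sym))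
                                             (ℕₚ.≤-trans (∣∣ᵥ-mono-≤ m≤a) (ℕₚ.≤-trans (ℕₚ.≤-reflexive (sym (rk≡∣∣ᵥ a∈P))) rk≤∣n∣)))
    sumAbove≡0 : sumAbove P n ≡ + 0
    sumAbove≡0 = trans (∑-filter (λ m → (n ≤ᵥ? m) ×-dec ¬? (m ≟ᵥ n)) B (c′ P)) (∑-zero B vanishes)
      where
      vanishes : ∀ m → ⟦ does ((n ≤ᵥ? m) ×-dec ¬? (m ≟ᵥ n)) ⟧ * c′ P m ≡ + 0
      vanishes m = by-cases ((n ≤ᵥ? m) ×-dec ¬? (m ≟ᵥ n))
        where
        by-cases : (d : Dec (n ≤ᵥ m × m ≢ n)) → ⟦ does d ⟧ * c′ P m ≡ + 0
        by-cases (no _)              = ℤₚ.*-zeroˡ (c′ P m)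
        by-cases (yes (n≤m , m≢n)) = trans (ℤₚ.*-identityˡ _) (c′-outside m (strictly-above-outside m n≤m m≢n))

open import Data.Integer using (+_; -_; _-_)
open import Data.Maybe using (just; nothing)
open import Data.Product using (_×_; _,_)
open import Relation.Nullary using (¬_)
open import Relation.Binary.PropositionalEquality using (_≡_)

theorem1p7 : ∀ {p : ℕ} (σ : Permutation′ p) (P : List (Vecℕ p))
    → AllPairs (LexLt σ) P
    → IsPolymatroid P
    → (∀ (n : Vecℕ p)
         → (InB P n → c′ P n ≡ + 1)
         × (InI P n → ¬ InB P n → c′ P n ≡ + 1 - sumAbove P n)
         × (¬ InI P n → c′ P n ≡ + 0))
      × (∀ (μ : Elt p → Elt p → ℤ) → IsMobius P μ → ∀ (n : Vecℕ p)
         → (InI P n → c′ P n ≡ - μ (just n) nothing)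
         × (¬ InI P n → c′ P n ≡ + 0))
theorem1p7 σ P sorted (sameRank , mConvex) =
  (λ n → c′-inB n , (λ n∈I _ → c′-inI n n∈I) , c′-outside n) ,
  (λ μ isMobius n → (λ n∈I → MöbiusInversion.unitUpwardSums⇒≡-μ P μ isMobius inI? InI⇒inBox n∈I (c′ P) c′-outside c′-upward)
                  , c′-outside n)
  where open Coefficients σ P sorted sameRank mConvex
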